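{- Let $G$ and $H$ be graphs such that $G$, $H$, $\overline{G}$ and $\overline{H}$ all have diameter $2$. Then: (1) $G$ and $H$ are generalized $A$-cospectral if and only if they are generalized $D$-cospectral; (2) $G$ and $H$ are generalized $L$-cospectral if and only if they are generalized $M$-cospectral for any $M\in\{D^L,D^{\deg}_+,A^{\operatorname{trs}}_+\}$; (3) $G$ and $H$ are generalized $Q$-cospectral if and only if they are generalized $M$-cospectral for any $M\in\{D^Q,D^{\deg},A^{\operatorname{trs}}\}$.
   Context: For a connected graph $G$ with adjacency matrix $A$, distance matrix $D$, degree vector $\deg(G)$ and transmission vector $\operatorname{trs}(G)$ ($\operatorname{trs}(v)=\sum_u d(u,v)$): $L=\operatorname{diag}(\deg(G))-A$, $Q=\operatorname{diag}(\deg(G))+A$, $D^L=\operatorname{diag}(\operatorname{trs}(G))-D$, $D^Q=\operatorname{diag}(\operatorname{trs}(G))+D$, $A^{\operatorname{trs}}=\operatorname{diag}(\operatorname{trs}(G))-A$, $A^{\operatorname{trs}}_+=\operatorname{diag}(\operatorname{trs}(G))+A$, $D^{\deg}=\operatorname{diag}(\deg(G))-D$, $D^{\deg}_+=\operatorname{diag}(\deg(G))+D$. $\overline{G}$ is the complement. $G$ and $H$ are generalized $M$-cospectral if $M(G),M(H)$ have the same multiset of eigenvalues and $M(\overline{G}),M(\overline{H})$ have the same multiset of eigenvalues. -}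

module Defs where

open import Data.Bool using (Bool; true; false; _∧_; _∨_; not; if_then_else_)
open import Data.Nat using (ℕ; zero; suc; _≤_)
open import Data.Integer using (ℤ; +_; -_; _+_; _*_; _-_)
open import Data.Fin using (Fin; zero; suc; punchIn; _≟_)
open import Data.List using (List; []; _∷_; map)
open import Data.Product using (_×_; ∃₂)
open import Relation.Nullary.Decidable using (⌊_⌋)
open import Relation.Binary.PropositionalEquality using (_≡_; refl)
open import Relation.Nullary using (yes; no)
open import Data.Empty using (⊥-elim)
open import Function.Bundles using (_⇔_)

record Graph (n : ℕ) : Set where
  field
    adj    : Fin n → Fin n → Bool
    sym    : ∀ u v → adj u v ≡ adj v u
    irrefl : ∀ v → adj v v ≡ false
open Graph public

eqB : ∀ {n} → Fin n → Fin n → Bool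
eqB i j = ⌊ i ≟ j ⌋

anyFin : ∀ {n} → (Fin n → Bool) → Bool
anyFin {zero}  f = false
anyFin {suc n} f = f zero ∨ anyFin (λ i → f (suc i))

sumℕ : ∀ {n} → (Fin n → ℕ) → ℕ
sumℕ {zero}  f = 0
sumℕ {suc n} f = f zero Data.Nat.+ sumℕ (λ i → f (suc i))

eqB-sym : ∀ {n} (u v : Fin n) → eqB u v ≡ eqB v u
eqB-sym u v with u ≟ v | v ≟ u
... | yes p | yes q = refl
... | yes refl | no q = ⊥-elim (q refl)
... | no p | yes refl = ⊥-elim (p refl)
... | no p | no q = refl

eqB-refl : ∀ {n} (v : Fin n) → eqB v v ≡ true
eqB-refl v with v ≟ v
... | yes _ = refl
... | no p = ⊥-elim (p refl)

compl-sym : ∀ {n} (G : Graph n) (u v : Fin n) →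
  (not (adj G u v) ∧ not (eqB u v)) ≡ (not (adj G v u) ∧ not (eqB v u))
compl-sym G u v rewrite sym G u v | eqB-sym u v = refl

compl-irrefl : ∀ {n} (G : Graph n) (v : Fin n) → (not (adj G v v) ∧ not (eqB v v)) ≡ false
compl-irrefl G v rewrite eqB-refl v | irrefl G v = refl

compl : ∀ {n} → Graph n → Graph n
compl G = record
  { adj    = λ u v → not (adj G u v) ∧ not (eqB u v)
  ; sym    = compl-sym G
  ; irrefl = compl-irrefl G }

reach : ∀ {n} → Graph n → ℕ → Fin n → Fin n → Bool
reach G zero    u v = eqB u v
reach G (suc k) u v = reach G k u v ∨ anyFin (λ w → reach G k u w ∧ adj G w v)

-- least k (searching k, k+1, ..., k+fuel-1) with reach G k u v; fallback k+fuel
search : ∀ {n} → Graph n → Fin n → Fin n → ℕ → ℕ → ℕ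
search G u v k zero       = k
search G u v k (suc fuel) = if reach G k u v then k else search G u v (suc k) fuel

-- distance d(u,v) = least k with a walk of length k (meaningful for connected G)
dist : ∀ {n} → Graph n → Fin n → Fin n → ℕ
dist {n} G u v = search G u v 0 n

Connected : ∀ {n} → Graph n → Set
Connected {n} G = ∀ u v → reach G n u v ≡ true

HasDiameter : ∀ {n} → Graph n → ℕ → Set
HasDiameter G d = Connected G × (∀ u v → dist G u v ≤ d) × ∃₂ (λ u v → dist G u v ≡ d)

deg : ∀ {n} → Graph n → Fin n → ℕ
deg G v = sumℕ (λ u → if adj G v u then 1 else 0)

trs : ∀ {n} → Graph n → Fin n → ℕ
trs G v = sumℕ (λ u → dist G u v)

Mat : ℕ → Set
Mat n = Fin n → Fin n → ℤ

diag : ∀ {n} → (Fin n → ℕ) → Mat n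
diag f i j = if eqB i j then + f i else + 0

_⊕_ _⊖_ : ∀ {n} → Mat n → Mat n → Mat n
(M ⊕ N) i j = M i j + N i j
(M ⊖ N) i j = M i j - N i j

Aₘ : ∀ {n} → Graph n → Mat n
Aₘ G i j = if adj G i j then + 1 else + 0

Dₘ : ∀ {n} → Graph n → Mat n
Dₘ G i j = + dist G i j

Lₘ Qₘ DLₘ DQₘ Atrsₘ Atrs+ₘ Ddegₘ Ddeg+ₘ : ∀ {n} → Graph n → Mat n
Lₘ G      = diag (deg G) ⊖ Aₘ G
Qₘ G      = diag (deg G) ⊕ Aₘ G
DLₘ G     = diag (trs G) ⊖ Dₘ G
DQₘ G     = diag (trs G) ⊕ Dₘ G
Atrsₘ G   = diag (trs G) ⊖ Aₘ G
Atrs+ₘ G  = diag (trs G) ⊕ Aₘ G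
Ddegₘ G   = diag (deg G) ⊖ Dₘ G
Ddeg+ₘ G  = diag (deg G) ⊕ Dₘ G

-- Polynomials over ℤ (coefficient lists, lowest degree first)

Poly : Set
Poly = List ℤ

_+P_ : Poly → Poly → Poly
[] +P q = q
(a ∷ p) +P [] = a ∷ p
(a ∷ p) +P (b ∷ q) = (a + b) ∷ (p +P q)

scaleP : ℤ → Poly → Poly
scaleP a p = map (a *_) p

_*P_ : Poly → Poly → Poly
[] *P q = []
(a ∷ p) *P q = scaleP a q +P (+ 0 ∷ (p *P q))

coeff : Poly → ℕ → ℤ
coeff []      k       = + 0
coeff (a ∷ p) zero    = a
coeff (a ∷ p) (suc k) = coeff p k

sign : ℕ → ℤ
sign zero    = + 1
sign (suc k) = - sign k

sumP : ∀ {n} → (Fin n → Poly) → Poly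
sumP {zero}  f = []
sumP {suc n} f = f zero +P sumP (λ i → f (suc i))

det : ∀ {n} → (Fin n → Fin n → Poly) → Poly
det {zero}  M = + 1 ∷ []
det {suc n} M = sumP (λ j → scaleP (sign (Data.Fin.toℕ j))
                   (M zero j *P det (λ i k → M (suc i) (punchIn j k))))

charPoly : ∀ {n} → Mat n → Poly
charPoly M = det (λ i j → (if eqB i j then (+ 0 ∷ + 1 ∷ []) else []) +P (- M i j ∷ []))

-- same multiset of eigenvalues (= same characteristic polynomial)
Cospectral : ∀ {n m} → Mat n → Mat m → Set
Cospectral M N = ∀ k → coeff (charPoly M) k ≡ coeff (charPoly N) k

MatFam : Set
MatFam = ∀ {n} → Graph n → Mat n

GenCospectral : MatFam → ∀ {n m} → Graph n → Graph m → Set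
GenCospectral M G H = Cospectral (M G) (M H) × Cospectral (M (compl G)) (M (compl H))

{-# OPTIONS --safe #-}
module Submission where

-- If G and its complement have diameter at most 2, every distance is 0, 1 or 2, so
-- D(G) = 2J − 2I − A(G), D(Ḡ) = J − I + A(G), and the degrees and transmissions of G and Ḡ
-- are affine in deg(G) with coefficients depending only on n. Hence for each of the ten
-- matrices M, both M(G) and M(Ḡ) have the form cI ± (B(G) + tJ) with B ∈ {A, L, Q}, where c, t
-- depend only on n and the two offsets t differ. The substitution x ↦ ±(x − c) shows that
-- cI ± N and cI ± N′ are cospectral iff N and N′ are, and by the rank-one expansion
-- det(xI − N − tJ) = χ_N(x) − t·1ᵀadj(xI − N)1 the matrices N + tJ and N′ + tJ are
-- cospectral for all t as soon as they are for two distinct values of t. So generalized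
-- M-cospectrality of G and H means that B(G) + tJ and B(H) + tJ are cospectral for every t,
-- which only depends on B. Graphs of different orders are never cospectral, since χ_N is
-- monic of degree the order of N.

open import Algebra.Bundles using (CommutativeRing)

module Determinant {c ℓ} (R : CommutativeRing c ℓ) where

  open import Data.Nat using (ℕ; zero; suc)
  open import Data.Fin using (Fin; zero; suc; punchIn; punchOut; toℕ)
  import Data.Fin.Properties as Fin
  open import Data.Vec.Functional using (updateAt)
  open import Data.Vec.Functional.Properties using (updateAt-updates; updateAt-minimal)
  open import Function using (_∘_; _∘₂_)
  open import Algebra.Morphism.Structures using (IsRingHomomorphism)
  open import Relation.Binary.PropositionalEquality as ≡ using (_≡_; _≢_)
  open import Relation.Nullary using (yes; no)
  open import Relation.Nullary.Negation using (contradiction)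

  open CommutativeRing R hiding (zero)
  open import Algebra.Properties.Ring ring using (-‿distribˡ-*; -‿distribʳ-*; -‿involutive)
  open import Algebra.Properties.Semiring.Sum semiring public using (sum)
  open import Algebra.Properties.Semiring.Sum semiring
    using (sum-cong-≋; sum-replicate-zero; ∑-distrib-+; ∑-comm; sum-remove; *-distribˡ-sum)
  open import Relation.Binary.Reasoning.Setoid setoid
  open import Algebra.Solver.Ring.NaturalCoefficients.Default commutativeSemiring using (solve; _:+_; _:*_; _:=_)

  Matrix : ℕ → Set c
  Matrix n = Fin n → Fin n → Carrier

  infix 4 _≈ₘ_
  _≈ₘ_ : ∀ {n} → Matrix n → Matrix n → Set ℓ
  M ≈ₘ N = ∀ i k → M i k ≈ N i k

  sign : ℕ → Carrier
  sign zero    = 1#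
  sign (suc k) = - sign k

  minor : ∀ {n} → Fin (suc n) → Matrix (suc n) → Matrix n
  minor j M i k = M (suc i) (punchIn j k)

  mutual
    det : ∀ {n} → Matrix n → Carrier
    det {zero}  M = 1#
    det {suc n} M = sum (laplaceTerm M)

    laplaceTerm : ∀ {n} → Matrix (suc n) → Fin (suc n) → Carrier
    laplaceTerm M j = sign (toℕ j) * (M zero j * det (minor j M))

  replaceRow : ∀ {n} → Fin n → (Fin n → Carrier) → Matrix n → Matrix n
  replaceRow r u M = updateAt M r (λ _ → u)

  minor-replaceRow : ∀ {n} j (r : Fin n) u (M : Matrix (suc n)) →
    minor j (replaceRow (suc r) u M) ≈ₘ replaceRow r (u ∘ punchIn j) (minor j M)
  minor-replaceRow j r u M i k with i Fin.≟ r
  ... | yes ≡.refl = reflexive (≡.trans (≡.cong (λ row → row (punchIn j k)) (updateAt-updates (suc i) M))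
                                        (≡.sym (≡.cong (λ row → row k) (updateAt-updates i (minor j M)))))
  ... | no i≢r     = reflexive (≡.trans
    (≡.cong (λ row → row (punchIn j k)) (updateAt-minimal (suc i) (suc r) M (i≢r ∘ Fin.suc-injective)))
    (≡.sym (≡.cong (λ row → row k) (updateAt-minimal i r (minor j M) i≢r))))

  neg-*-neg : ∀ x y → - x * - y ≈ x * y
  neg-*-neg x y = begin
    - x * - y      ≈⟨ -‿distribˡ-* x (- y) ⟨
    - (x * - y)    ≈⟨ -‿cong (-‿distribʳ-* x y) ⟨
    - - (x * y)    ≈⟨ -‿involutive (x * y) ⟩
    x * y          ∎

  sign-squared : ∀ k → sign k * sign k ≈ 1#
  sign-squared zero    = *-identityˡ 1#
  sign-squared (suc k) = trans (neg-*-neg (sign k) (sign k)) (sign-squared k)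

  sign-*-cancelˡ : ∀ k {x y} → sign k * x ≈ sign k * y → x ≈ y
  sign-*-cancelˡ k {x} {y} eq = begin
    x                       ≈⟨ *-identityˡ x ⟨
    1# * x                  ≈⟨ *-congʳ (sign-squared k) ⟨
    (sign k * sign k) * x   ≈⟨ *-assoc _ _ _ ⟩
    sign k * (sign k * x)   ≈⟨ *-congˡ {sign k} eq ⟩
    sign k * (sign k * y)   ≈⟨ *-assoc _ _ _ ⟨
    (sign k * sign k) * y   ≈⟨ *-congʳ (sign-squared k) ⟩
    1# * y                  ≈⟨ *-identityˡ y ⟩
    y                       ∎

  sign-punchOut-antisymmetric : ∀ {n} {j c : Fin (suc n)} (j≢c : j ≢ c) (c≢j : c ≢ j) →
    sign (toℕ j) * sign (toℕ (punchOut j≢c)) + sign (toℕ c) * sign (toℕ (punchOut c≢j)) ≈ 0#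
  sign-punchOut-antisymmetric {j = zero} {zero} j≢c _ = contradiction ≡.refl j≢c
  sign-punchOut-antisymmetric {suc n} {zero} {suc c} _ _ =
    trans (+-cong (*-identityˡ _) (*-identityʳ _)) (-‿inverseʳ _)
  sign-punchOut-antisymmetric {suc n} {suc j} {zero} _ _ =
    trans (+-cong (*-identityʳ _) (*-identityˡ _)) (-‿inverseˡ _)
  sign-punchOut-antisymmetric {suc n} {suc j} {suc c} j≢c c≢j =
    trans (+-cong (neg-*-neg _ _) (neg-*-neg _ _))
          (sign-punchOut-antisymmetric (j≢c ∘ ≡.cong suc) (c≢j ∘ ≡.cong suc))

  punchIn-punchIn-comm : ∀ {n} {j c : Fin (suc (suc n))} (j≢c : j ≢ c) (c≢j : c ≢ j) (l : Fin n) →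
    punchIn j (punchIn (punchOut j≢c) l) ≡ punchIn c (punchIn (punchOut c≢j) l)
  punchIn-punchIn-comm {j = zero}  {zero}  j≢c _ l = contradiction ≡.refl j≢c
  punchIn-punchIn-comm {j = zero}  {suc c} _   _ l = ≡.refl
  punchIn-punchIn-comm {j = suc j} {zero}  _   _ l = ≡.refl
  punchIn-punchIn-comm {suc n} {suc j} {suc c} _ _ zero = ≡.refl
  punchIn-punchIn-comm {suc n} {suc j} {suc c} j≢c c≢j (suc l) =
    ≡.cong suc (punchIn-punchIn-comm (j≢c ∘ ≡.cong suc) (c≢j ∘ ≡.cong suc) l)

  sum-zero : ∀ {n} (f : Fin n → Carrier) → (∀ i → f i ≈ 0#) → sum f ≈ 0#
  sum-zero {n} f f≈0 = trans (sum-cong-≋ f≈0) (sum-replicate-zero n)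

  sum-antisymmetric : ∀ {n} (h : Fin n → Fin n → Carrier) → (∀ i → h i i ≈ 0#) →
    (∀ i j → h i j + h j i ≈ 0#) → sum (λ i → sum (h i)) ≈ 0#
  sum-antisymmetric {zero}  h diagonal anti = refl
  sum-antisymmetric {suc n} h diagonal anti = begin
    (h zero zero + row) + sum (λ i → h (suc i) zero + sum (λ j → h (suc i) (suc j)))
      ≈⟨ +-cong (+-congʳ (diagonal zero))
                (∑-distrib-+ (λ i → h (suc i) zero) (λ i → sum (λ j → h (suc i) (suc j)))) ⟩
    (0# + row) + (column + rest)
      ≈⟨ trans (+-congʳ (+-identityˡ row)) (sym (+-assoc row column rest)) ⟩
    (row + column) + rest
      ≈⟨ +-cong (sym (∑-distrib-+ (λ j → h zero (suc j)) (λ j → h (suc j) zero)))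
                (sum-antisymmetric (λ i j → h (suc i) (suc j)) (diagonal ∘ suc) (λ i j → anti (suc i) (suc j))) ⟩
    sum (λ j → h zero (suc j) + h (suc j) zero) + 0#
      ≈⟨ trans (+-identityʳ _) (sum-zero _ (λ j → anti zero (suc j))) ⟩
    0# ∎
    where
    row    = sum (λ j → h zero (suc j))
    column = sum (λ i → h (suc i) zero)
    rest   = sum (λ i → sum (λ j → h (suc i) (suc j)))

  sum-interchange : ∀ {m n} (s w : Fin m → Carrier) (b : Fin n → Carrier) (e : Fin n → Fin m → Carrier) →
    sum (λ j → s j * (w j * sum (λ i → b i * e i j))) ≈ sum (λ i → b i * sum (λ j → s j * (w j * e i j)))
  sum-interchange s w b e = begin
    sum (λ j → s j * (w j * sum (λ i → b i * e i j)))
      ≈⟨ sum-cong-≋ (λ j → trans (*-congˡ {s j} (*-distribˡ-sum (w j) (λ i → b i * e i j)))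
                                 (*-distribˡ-sum (s j) (λ i → w j * (b i * e i j)))) ⟩
    sum (λ j → sum (λ i → s j * (w j * (b i * e i j))))
      ≈⟨ ∑-comm (λ j i → s j * (w j * (b i * e i j))) ⟩
    sum (λ i → sum (λ j → s j * (w j * (b i * e i j))))
      ≈⟨ sum-cong-≋ (λ i → trans (sum-cong-≋ (λ j → shuffle (s j) (w j) (b i) (e i j)))
                                 (sym (*-distribˡ-sum (b i) (λ j → s j * (w j * e i j))))) ⟩
    sum (λ i → b i * sum (λ j → s j * (w j * e i j))) ∎
    where
    shuffle : ∀ s w b e → s * (w * (b * e)) ≈ b * (s * (w * e))
    shuffle = solve 4 (λ s w b e → s :* (w :* (b :* e)) := b :* (s :* (w :* e))) refl

  det-cong : ∀ {n} {M N : Matrix n} → M ≈ₘ N → det M ≈ det N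
  det-cong {zero}  M≈N = refl
  det-cong {suc n} M≈N = sum-cong-≋ λ j →
    *-congˡ {sign (toℕ j)} (*-cong (M≈N zero j) (det-cong λ i k → M≈N (suc i) (punchIn j k)))

  det-replaceRow-additive : ∀ {n} (r : Fin n) (u v : Fin n → Carrier) (M : Matrix n) →
    det (replaceRow r (λ k → u k + v k) M) ≈ det (replaceRow r u M) + det (replaceRow r v M)
  det-replaceRow-additive {suc n} zero u v M = begin
    sum (λ j → s j * ((u j + v j) * d j))
      ≈⟨ sum-cong-≋ (λ j → trans (*-congˡ {s j} (distribʳ (d j) (u j) (v j)))
                                 (distribˡ (s j) (u j * d j) (v j * d j))) ⟩
    sum (λ j → s j * (u j * d j) + s j * (v j * d j))
      ≈⟨ ∑-distrib-+ (λ j → s j * (u j * d j)) (λ j → s j * (v j * d j)) ⟩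
    sum (laplaceTerm (replaceRow zero u M)) + sum (laplaceTerm (replaceRow zero v M)) ∎
    where
    s d : Fin (suc n) → Carrier
    s j = sign (toℕ j)
    d j = det (minor j M)
  det-replaceRow-additive {suc n} (suc r) u v M = begin
    sum (λ j → s j * (M zero j * det (minor j (replaceRow (suc r) (λ k → u k + v k) M))))
      ≈⟨ sum-cong-≋ (λ j → *-congˡ {s j} (*-congˡ {M zero j}
           (trans (det-cong (minor-replaceRow j r (λ k → u k + v k) M))
                  (det-replaceRow-additive r (u ∘ punchIn j) (v ∘ punchIn j) (minor j M))))) ⟩
    sum (λ j → s j * (M zero j * (du j + dv j)))
      ≈⟨ sum-cong-≋ (λ j → trans (*-congˡ {s j} (distribˡ (M zero j) (du j) (dv j)))
                                 (distribˡ (s j) (M zero j * du j) (M zero j * dv j))) ⟩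
    sum (λ j → s j * (M zero j * du j) + s j * (M zero j * dv j))
      ≈⟨ ∑-distrib-+ (λ j → s j * (M zero j * du j)) (λ j → s j * (M zero j * dv j)) ⟩
    sum (λ j → s j * (M zero j * du j)) + sum (λ j → s j * (M zero j * dv j))
      ≈⟨ sym (+-cong (sum-cong-≋ λ j → *-congˡ {s j} (*-congˡ {M zero j} (det-cong (minor-replaceRow j r u M))))
                     (sum-cong-≋ λ j → *-congˡ {s j} (*-congˡ {M zero j} (det-cong (minor-replaceRow j r v M))))) ⟩
    det (replaceRow (suc r) u M) + det (replaceRow (suc r) v M) ∎
    where
    s du dv : Fin (suc n) → Carrier
    s j  = sign (toℕ j)
    du j = det (replaceRow r (u ∘ punchIn j) (minor j M))
    dv j = det (replaceRow r (v ∘ punchIn j) (minor j M))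

  offDiagonal : ∀ {m} → (Fin (suc m) → Fin m → Carrier) → Fin (suc m) → Fin (suc m) → Carrier
  offDiagonal F j c with j Fin.≟ c
  ... | yes _  = 0#
  ... | no j≢c = F j (punchOut j≢c)

  offDiagonal-diagonal : ∀ {m} (F : Fin (suc m) → Fin m → Carrier) j → offDiagonal F j j ≈ 0#
  offDiagonal-diagonal F j with j Fin.≟ j
  ... | yes _  = refl
  ... | no j≢j = contradiction ≡.refl j≢j

  sum-offDiagonal : ∀ {m} (F : Fin (suc m) → Fin m → Carrier) j → sum (F j) ≈ sum (offDiagonal F j)
  sum-offDiagonal F j = sym (begin
    sum (offDiagonal F j)                                  ≈⟨ sum-remove {i = j} (offDiagonal F j) ⟩
    offDiagonal F j j + sum (offDiagonal F j ∘ punchIn j)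
      ≈⟨ +-cong (offDiagonal-diagonal F j) (sum-cong-≋ atPunchIn) ⟩
    0# + sum (F j)                                         ≈⟨ +-identityˡ _ ⟩
    sum (F j)                                              ∎)
    where
    atPunchIn : ∀ k → offDiagonal F j (punchIn j k) ≈ F j k
    atPunchIn k with j Fin.≟ punchIn j k
    ... | yes j≡ = contradiction (≡.sym j≡) (Fin.punchInᵢ≢i j k)
    ... | no _   = reflexive (≡.cong (F j) (≡.trans (Fin.punchOut-cong j ≡.refl) (Fin.punchOut-punchIn j)))

  offDiagonal-antisymmetric : ∀ {m} (F : Fin (suc m) → Fin m → Carrier) →
    (∀ j c (j≢c : j ≢ c) (c≢j : c ≢ j) → F j (punchOut j≢c) + F c (punchOut c≢j) ≈ 0#) →
    ∀ j c → offDiagonal F j c + offDiagonal F c j ≈ 0#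
  offDiagonal-antisymmetric F anti j c with j Fin.≟ c | c Fin.≟ j
  ... | yes _   | yes _   = +-identityˡ 0#
  ... | yes j≡c | no c≢j  = contradiction (≡.sym j≡c) c≢j
  ... | no j≢c  | yes c≡j = contradiction (≡.sym c≡j) j≢c
  ... | no j≢c  | no c≢j  = anti j c j≢c c≢j

  -- Expanding along the first two rows, the terms for the column pairs (j, c) and (c, j) cancel.
  det-firstRowsEqual : ∀ {n} (M : Matrix (suc (suc n))) → (∀ l → M zero l ≈ M (suc zero) l) → det M ≈ 0#
  det-firstRowsEqual {n} M row₀≈row₁ = begin
    sum (λ j → s j * (M zero j * sum (G j)))
      ≈⟨ sum-cong-≋ (λ j → trans (*-congˡ {s j} (*-distribˡ-sum (M zero j) (G j)))
                                 (*-distribˡ-sum (s j) (λ k → M zero j * G j k))) ⟩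
    sum (λ j → sum (F j))                ≈⟨ sum-cong-≋ (sum-offDiagonal F) ⟩
    sum (λ j → sum (offDiagonal F j))
      ≈⟨ sum-antisymmetric (offDiagonal F) (offDiagonal-diagonal F) (offDiagonal-antisymmetric F cancel) ⟩
    0# ∎
    where
    s : ∀ {m} → Fin m → Carrier
    s j = sign (toℕ j)
    D G F : Fin (suc (suc n)) → Fin (suc n) → Carrier
    D j k = det (minor k (minor j M))
    G j k = s k * (M (suc zero) (punchIn j k) * D j k)
    F j k = s j * (M zero j * G j k)
    normalise : ∀ j c (j≢c : j ≢ c) →
      F j (punchOut j≢c) ≈ (s j * s (punchOut j≢c)) * ((M zero j * M zero c) * D j (punchOut j≢c))
    normalise j c j≢c = trans
      (*-congˡ {s j} (*-congˡ {M zero j} (*-congˡ {s (punchOut j≢c)} (*-congʳ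
        (trans (reflexive (≡.cong (M (suc zero)) (Fin.punchIn-punchOut j≢c))) (sym (row₀≈row₁ c)))))))
      (solve 5 (λ a b c d e → a :* (b :* (c :* (d :* e))) := (a :* c) :* ((b :* d) :* e)) refl _ _ _ _ _)
    cancel : ∀ j c (j≢c : j ≢ c) (c≢j : c ≢ j) → F j (punchOut j≢c) + F c (punchOut c≢j) ≈ 0#
    cancel j c j≢c c≢j = begin
      F j (punchOut j≢c) + F c (punchOut c≢j)
        ≈⟨ +-cong (normalise j c j≢c) (normalise c j c≢j) ⟩
      σ * X + τ * ((M zero c * M zero j) * D c (punchOut c≢j))
        ≈⟨ +-congˡ (*-congˡ {τ} (*-cong (*-comm _ _) (det-cong λ i l →
             reflexive (≡.cong (M (suc (suc i))) (punchIn-punchIn-comm c≢j j≢c l))))) ⟩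
      σ * X + τ * X   ≈⟨ distribʳ X σ τ ⟨
      (σ + τ) * X     ≈⟨ *-congʳ (sign-punchOut-antisymmetric j≢c c≢j) ⟩
      0# * X          ≈⟨ zeroˡ X ⟩
      0# ∎
      where
      σ = s j * s (punchOut j≢c)
      τ = s c * s (punchOut c≢j)
      X = (M zero j * M zero c) * D j (punchOut j≢c)

  alternating⇒antisymmetric : ∀ {a} {V : Set a} (_⊞_ : V → V → V) (φ : V → V → Carrier) →
    (∀ x y z → φ (x ⊞ y) z ≈ φ x z + φ y z) → (∀ x y z → φ x (y ⊞ z) ≈ φ x y + φ x z) →
    (∀ x → φ x x ≈ 0#) → ∀ x y → φ x y + φ y x ≈ 0#
  alternating⇒antisymmetric _⊞_ φ additiveˡ additiveʳ alternating x y = begin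
    φ x y + φ y x                       ≈⟨ +-cong (+-identityˡ _) (+-identityʳ _) ⟨
    (0# + φ x y) + (φ y x + 0#)         ≈⟨ +-cong (+-congʳ (alternating x)) (+-congˡ (alternating y)) ⟨
    (φ x x + φ x y) + (φ y x + φ y y)   ≈⟨ +-cong (additiveʳ x x y) (additiveʳ y x y) ⟨
    φ x (x ⊞ y) + φ y (x ⊞ y)           ≈⟨ additiveˡ x y (x ⊞ y) ⟨
    φ (x ⊞ y) (x ⊞ y)                   ≈⟨ alternating (x ⊞ y) ⟩
    0# ∎

  swapFirstRows : ∀ {n} → Matrix (suc (suc n)) → Matrix (suc (suc n))
  swapFirstRows M = replaceRow zero (M (suc zero)) (replaceRow (suc zero) (M zero) M)

  det-swapFirstRows : ∀ {n} (M : Matrix (suc (suc n))) → det (swapFirstRows M) + det M ≈ 0#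
  det-swapFirstRows {n} M = trans (+-congˡ (det-cong (sym ∘₂ unswap)))
    (alternating⇒antisymmetric _⊞_ φ additiveˡ additiveʳ alternating (M (suc zero)) (M zero))
    where
    Row = Fin (suc (suc n)) → Carrier
    _⊞_ : Row → Row → Row
    (x ⊞ y) k = x k + y k
    φ : Row → Row → Carrier
    φ x y = det (replaceRow zero x (replaceRow (suc zero) y M))
    reorder : ∀ x y → replaceRow zero x (replaceRow (suc zero) y M) ≈ₘ replaceRow (suc zero) y (replaceRow zero x M)
    reorder x y = λ { zero k → refl ; (suc zero) k → refl ; (suc (suc i)) k → refl }
    unswap : replaceRow zero (M zero) (replaceRow (suc zero) (M (suc zero)) M) ≈ₘ M
    unswap = λ { zero k → refl ; (suc zero) k → refl ; (suc (suc i)) k → refl }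
    additiveˡ : ∀ x y z → φ (x ⊞ y) z ≈ φ x z + φ y z
    additiveˡ x y z = det-replaceRow-additive zero x y (replaceRow (suc zero) z M)
    additiveʳ : ∀ x y z → φ x (y ⊞ z) ≈ φ x y + φ x z
    additiveʳ x y z = begin
      φ x (y ⊞ z)
        ≈⟨ det-cong (reorder x (y ⊞ z)) ⟩
      det (replaceRow (suc zero) (y ⊞ z) (replaceRow zero x M))
        ≈⟨ det-replaceRow-additive (suc zero) y z (replaceRow zero x M) ⟩
      det (replaceRow (suc zero) y (replaceRow zero x M)) + det (replaceRow (suc zero) z (replaceRow zero x M))
        ≈⟨ +-cong (det-cong (reorder x y)) (det-cong (reorder x z)) ⟨
      φ x y + φ x z ∎
    alternating : ∀ x → φ x x ≈ 0#
    alternating x = det-firstRowsEqual (replaceRow zero x (replaceRow (suc zero) x M)) (λ _ → refl)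

  mutual
    det-equalRows : ∀ {n} (M : Matrix n) {i k} → i ≢ k → (∀ l → M i l ≈ M k l) → det M ≈ 0#
    det-equalRows {suc n} M {zero}  {zero}  i≢k _   = contradiction ≡.refl i≢k
    det-equalRows {suc n} M {zero}  {suc k} _   i≈k = det-firstRowRepeated k M i≈k
    det-equalRows {suc n} M {suc i} {zero}  _   i≈k = det-firstRowRepeated i M (sym ∘ i≈k)
    det-equalRows {suc n} M {suc i} {suc k} i≢k i≈k = det-laterRowsEqual M (i≢k ∘ ≡.cong suc) i≈k

    det-laterRowsEqual : ∀ {n} (M : Matrix (suc n)) {i k : Fin n} → i ≢ k →
      (∀ l → M (suc i) l ≈ M (suc k) l) → det M ≈ 0#
    det-laterRowsEqual M i≢k i≈k = sum-zero (laplaceTerm M) λ j →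
      trans (*-congˡ {sign (toℕ j)} (trans (*-congˡ {M zero j}
        (det-equalRows (minor j M) i≢k (λ l → i≈k (punchIn j l)))) (zeroʳ _))) (zeroʳ _)

    det-firstRowRepeated : ∀ {n} (k : Fin n) (M : Matrix (suc n)) →
      (∀ l → M zero l ≈ M (suc k) l) → det M ≈ 0#
    det-firstRowRepeated zero    M 0≈1 = det-firstRowsEqual M 0≈1
    det-firstRowRepeated (suc k) M 0≈k = begin
      det M                           ≈⟨ +-identityˡ _ ⟨
      0# + det M                      ≈⟨ +-congʳ (det-laterRowsEqual (swapFirstRows M) {zero} {suc k} (λ ()) 0≈k) ⟨
      det (swapFirstRows M) + det M   ≈⟨ det-swapFirstRows M ⟩
      0# ∎

  det-rankOneUpdate : ∀ {n} (N : Matrix n) (a u : Fin n → Carrier) →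
    det (λ i k → N i k + a i * u k) ≈ det N + sum (λ i → a i * det (replaceRow i u N))
  det-rankOneUpdate {zero}  N a u = sym (+-identityʳ 1#)
  det-rankOneUpdate {suc n} N a u = begin
    sum (λ j → s j * ((N zero j + a zero * u j) * det (minor j P)))
      ≈⟨ sum-cong-≋ (λ j → *-congˡ {s j} (*-congˡ {N zero j + a zero * u j} (minor-update j))) ⟩
    sum (λ j → s j * ((N zero j + a zero * u j) * (D j + T j)))
      ≈⟨ sum-cong-≋ (λ j → expand (s j) (N zero j) (a zero) (u j) (D j) (T j)) ⟩
    sum (λ j → (f₁ j + f₂ j) + (f₃ j + f₄ j))
      ≈⟨ trans (∑-distrib-+ (λ j → f₁ j + f₂ j) (λ j → f₃ j + f₄ j))
               (+-cong (∑-distrib-+ f₁ f₂) (∑-distrib-+ f₃ f₄)) ⟩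
    (sum f₁ + sum f₂) + (sum f₃ + sum f₄)
      ≈⟨ +-cong (+-congˡ (sym (*-distribˡ-sum (a zero) (λ j → s j * (u j * D j)))))
                (+-cong (sum-interchange s (N zero) (a ∘ suc) E) vanishing) ⟩
    (det N + a zero * det (replaceRow zero u N)) + (sum (λ i → a (suc i) * det (replaceRow (suc i) u N)) + 0#)
      ≈⟨ trans (+-congˡ (+-identityʳ _)) (+-assoc _ _ _) ⟩
    det N + sum (λ i → a i * det (replaceRow i u N)) ∎
    where
    s D T f₁ f₂ f₃ f₄ : Fin (suc n) → Carrier
    s j = sign (toℕ j)
    P : Matrix (suc n)
    P i k = N i k + a i * u k
    E : Fin n → Fin (suc n) → Carrier
    E i j = det (minor j (replaceRow (suc i) u N))
    D j = det (minor j N)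
    T j = sum (λ i → a (suc i) * E i j)
    f₁ j = s j * (N zero j * D j)
    f₂ j = a zero * (s j * (u j * D j))
    f₃ j = s j * (N zero j * T j)
    f₄ j = a zero * (s j * (u j * T j))
    expand : ∀ s x a y d t → s * ((x + a * y) * (d + t)) ≈
      (s * (x * d) + a * (s * (y * d))) + (s * (x * t) + a * (s * (y * t)))
    expand = solve 6 (λ s x a y d t → s :* ((x :+ a :* y) :* (d :+ t)) :=
      (s :* (x :* d) :+ a :* (s :* (y :* d))) :+ (s :* (x :* t) :+ a :* (s :* (y :* t)))) refl
    minor-update : ∀ j → det (minor j P) ≈ D j + T j
    minor-update j = trans (det-rankOneUpdate (minor j N) (a ∘ suc) (u ∘ punchIn j))
      (+-congˡ (sum-cong-≋ λ i → *-congˡ {a (suc i)} (det-cong (sym ∘₂ minor-replaceRow j i u N))))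
    -- the quadratic term expands matrices whose rows 0 and i + 1 both equal u
    vanishing : sum f₄ ≈ 0#
    vanishing = begin
      sum f₄                                   ≈⟨ *-distribˡ-sum (a zero) (λ j → s j * (u j * T j)) ⟨
      a zero * sum (λ j → s j * (u j * T j))
        ≈⟨ *-congˡ {a zero} (trans (sum-interchange s u (a ∘ suc) E) (sum-zero _ λ i →
             trans (*-congˡ {a (suc i)} (det-firstRowRepeated i (replaceRow zero u (replaceRow (suc i) u N))
               λ l → reflexive (≡.sym (≡.cong (λ row → row l) (updateAt-updates (suc i) N)))))
             (zeroʳ _))) ⟩
      a zero * 0#                              ≈⟨ zeroʳ _ ⟩
      0# ∎

  det-negate : ∀ {n} (M : Matrix n) → det (λ i k → - M i k) ≈ sign n * det M
  det-negate {zero}  M = sym (*-identityˡ 1#)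
  det-negate {suc n} M = begin
    sum (λ j → sign (toℕ j) * (- M zero j * det (λ i k → - minor j M i k)))
      ≈⟨ sum-cong-≋ (λ j → trans (*-congˡ {sign (toℕ j)} (*-congˡ {(- M zero j)} (det-negate (minor j M))))
                                 (pull-sign (sign (toℕ j)) (M zero j) (sign n) (det (minor j M)))) ⟩
    sum (λ j → sign (suc n) * laplaceTerm M j)   ≈⟨ *-distribˡ-sum (sign (suc n)) (laplaceTerm M) ⟨
    sign (suc n) * det M ∎
    where
    rearrange : ∀ s x t d → s * (x * (t * d)) ≈ t * (s * (x * d))
    rearrange = solve 4 (λ s x t d → s :* (x :* (t :* d)) := t :* (s :* (x :* d))) refl
    pull-sign : ∀ s x t d → s * (- x * (t * d)) ≈ - t * (s * (x * d))
    pull-sign s x t d = begin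
      s * (- x * (t * d))     ≈⟨ *-congˡ {s} (-‿distribˡ-* x (t * d)) ⟨
      s * - (x * (t * d))     ≈⟨ -‿distribʳ-* s (x * (t * d)) ⟨
      - (s * (x * (t * d)))   ≈⟨ -‿cong (rearrange s x t d) ⟩
      - (t * (s * (x * d)))   ≈⟨ -‿distribˡ-* t (s * (x * d)) ⟩
      - t * (s * (x * d))     ∎

  module _ {f : Carrier → Carrier} (f-homo : IsRingHomomorphism rawRing rawRing f) where
    open IsRingHomomorphism f-homo

    sum-homomorphic : ∀ {n} (g : Fin n → Carrier) → f (sum g) ≈ sum (f ∘ g)
    sum-homomorphic {zero}  g = 0#-homo
    sum-homomorphic {suc n} g = trans (+-homo _ _) (+-congˡ (sum-homomorphic (g ∘ suc)))

    sign-homomorphic : ∀ k → f (sign k) ≈ sign k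
    sign-homomorphic zero    = 1#-homo
    sign-homomorphic (suc k) = trans (-‿homo _) (-‿cong (sign-homomorphic k))

    det-homomorphic : ∀ {n} (M : Matrix n) → det (λ i k → f (M i k)) ≈ f (det M)
    det-homomorphic {zero}  M = sym 1#-homo
    det-homomorphic {suc n} M = sym (trans (sum-homomorphic (laplaceTerm M)) (sum-cong-≋ λ j →
      trans (*-homo _ _) (*-cong (sign-homomorphic (toℕ j))
        (trans (*-homo _ _) (*-congˡ {f (M zero j)} (sym (det-homomorphic (minor j M))))))))

open import Defs hiding (det; sign)
import Defs

module FinEquality where

  open import Data.Bool using (false)
  open import Data.Fin using (Fin; suc)
  open import Data.Nat using (suc)
  import Data.Fin.Properties as Fin
  open import Function using (_∘_)
  open import Relation.Binary.PropositionalEquality as ≡ using (_≡_; _≢_; refl)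
  open import Relation.Nullary using (Dec; yes; no)
  open import Relation.Nullary.Negation using (contradiction)

  eqB-≢ : ∀ {n} {i j : Fin n} → i ≢ j → eqB i j ≡ false
  eqB-≢ {i = i} {j} i≢j with i Fin.≟ j
  ... | yes i≡j = contradiction i≡j i≢j
  ... | no _    = refl

  eqB-suc : ∀ {n} (i j : Fin n) → eqB {suc n} (suc i) (suc j) ≡ eqB i j
  eqB-suc i j = by-cases (i Fin.≟ j)
    where
    by-cases : Dec (i ≡ j) → eqB (suc i) (suc j) ≡ eqB i j
    by-cases (yes ≡.refl) = ≡.trans (eqB-refl (suc i)) (≡.sym (eqB-refl i))
    by-cases (no i≢j)     = ≡.trans (eqB-≢ (i≢j ∘ Fin.suc-injective)) (≡.sym (eqB-≢ i≢j))

open FinEquality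

module Polynomials where

  open import Algebra.Structures using (IsCommutativeRing)
  open import Data.Nat as ℕ using (zero; suc)
  open import Data.Integer using (+_; -_; _+_; _*_)
  import Data.Integer.Properties as ℤ
  open import Data.Integer.Tactic.RingSolver using (solve-∀)
  open import Data.List using ([]; _∷_; map)
  open import Data.Product using (_,_)
  open import Function.Bundles using (_⇔_; mk⇔)
  open import Relation.Binary.PropositionalEquality as ≡ using (_≡_; refl; cong; cong₂)
  open ≡.≡-Reasoning

  -- Coefficient lists are compared coefficientwise, so trailing zeros are immaterial.
  infix 4 _≈ₚ_
  record _≈ₚ_ (p q : Poly) : Set where
    constructor coeffwise
    field coeff-≡ : ∀ k → coeff p k ≡ coeff q k
  open _≈ₚ_ public

  negP : Poly → Poly
  negP = map -_

  tailP : Poly → Poly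
  tailP []      = []
  tailP (a ∷ p) = p

  coeff-+P : ∀ p q k → coeff (p +P q) k ≡ coeff p k + coeff q k
  coeff-+P []      q       k       = ≡.sym (ℤ.+-identityˡ _)
  coeff-+P (a ∷ p) []      k       = ≡.sym (ℤ.+-identityʳ _)
  coeff-+P (a ∷ p) (b ∷ q) zero    = refl
  coeff-+P (a ∷ p) (b ∷ q) (suc k) = coeff-+P p q k

  coeff-scaleP : ∀ a p k → coeff (scaleP a p) k ≡ a * coeff p k
  coeff-scaleP a []      k       = ≡.sym (ℤ.*-zeroʳ a)
  coeff-scaleP a (b ∷ p) zero    = refl
  coeff-scaleP a (b ∷ p) (suc k) = coeff-scaleP a p k

  coeff-negP : ∀ p k → coeff (negP p) k ≡ - coeff p k
  coeff-negP []      k       = refl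
  coeff-negP (a ∷ p) zero    = refl
  coeff-negP (a ∷ p) (suc k) = coeff-negP p k

  coeff-tailP : ∀ p k → coeff (tailP p) k ≡ coeff p (suc k)
  coeff-tailP []      k = refl
  coeff-tailP (a ∷ p) k = refl

  coeff-*P-zero : ∀ p q → coeff (p *P q) 0 ≡ coeff p 0 * coeff q 0
  coeff-*P-zero []      q = ≡.sym (ℤ.*-zeroˡ (coeff q 0))
  coeff-*P-zero (a ∷ p) q = begin
    coeff (scaleP a q +P (+ 0 ∷ (p *P q))) 0  ≡⟨ coeff-+P (scaleP a q) (+ 0 ∷ (p *P q)) 0 ⟩
    coeff (scaleP a q) 0 + + 0                ≡⟨ ℤ.+-identityʳ _ ⟩
    coeff (scaleP a q) 0                      ≡⟨ coeff-scaleP a q 0 ⟩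
    a * coeff q 0                             ∎

  coeff-*P-suc : ∀ p q k → coeff (p *P q) (suc k) ≡ coeff p 0 * coeff q (suc k) + coeff (tailP p *P q) k
  coeff-*P-suc []      q k = ≡.sym (cong (_+ + 0) (ℤ.*-zeroˡ (coeff q (suc k))))
  coeff-*P-suc (a ∷ p) q k = ≡.trans (coeff-+P (scaleP a q) (+ 0 ∷ (p *P q)) (suc k))
                                     (cong (_+ coeff (p *P q) k) (coeff-scaleP a q (suc k)))

  ≈ₚ-refl : ∀ {p} → p ≈ₚ p
  ≈ₚ-refl = coeffwise λ _ → refl

  ≈ₚ-reflexive : ∀ {p q} → p ≡ q → p ≈ₚ q
  ≈ₚ-reflexive refl = ≈ₚ-refl

  ≈ₚ-sym : ∀ {p q} → p ≈ₚ q → q ≈ₚ p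
  ≈ₚ-sym p≈q = coeffwise λ k → ≡.sym (coeff-≡ p≈q k)

  ≈ₚ-trans : ∀ {p q r} → p ≈ₚ q → q ≈ₚ r → p ≈ₚ r
  ≈ₚ-trans p≈q q≈r = coeffwise λ k → ≡.trans (coeff-≡ p≈q k) (coeff-≡ q≈r k)

  ≈ₚ-cong⇔ : ∀ {p p′ q q′} → p ≈ₚ p′ → q ≈ₚ q′ → (p ≈ₚ q) ⇔ (p′ ≈ₚ q′)
  ≈ₚ-cong⇔ p≈p′ q≈q′ = mk⇔ (λ p≈q → ≈ₚ-trans (≈ₚ-sym p≈p′) (≈ₚ-trans p≈q q≈q′))
                           (λ p′≈q′ → ≈ₚ-trans p≈p′ (≈ₚ-trans p′≈q′ (≈ₚ-sym q≈q′)))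

  tailP-cong : ∀ {p q} → p ≈ₚ q → tailP p ≈ₚ tailP q
  tailP-cong {p} {q} p≈q = coeffwise λ k →
    ≡.trans (coeff-tailP p k) (≡.trans (coeff-≡ p≈q (suc k)) (≡.sym (coeff-tailP q k)))

  +P-cong : ∀ {p p′ q q′} → p ≈ₚ p′ → q ≈ₚ q′ → p +P q ≈ₚ p′ +P q′
  +P-cong {p} {p′} {q} {q′} p≈p′ q≈q′ = coeffwise λ k →
    ≡.trans (coeff-+P p q k) (≡.trans (cong₂ _+_ (coeff-≡ p≈p′ k) (coeff-≡ q≈q′ k)) (≡.sym (coeff-+P p′ q′ k)))

  *P-cong : ∀ {p p′ q q′} → p ≈ₚ p′ → q ≈ₚ q′ → p *P q ≈ₚ p′ *P q′
  *P-cong {p} {p′} {q} {q′} p≈p′ q≈q′ = coeffwise (go p p′ p≈p′)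
    where
    go : ∀ p p′ → p ≈ₚ p′ → ∀ k → coeff (p *P q) k ≡ coeff (p′ *P q′) k
    go p p′ e zero    = ≡.trans (coeff-*P-zero p q)
      (≡.trans (cong₂ _*_ (coeff-≡ e 0) (coeff-≡ q≈q′ 0)) (≡.sym (coeff-*P-zero p′ q′)))
    go p p′ e (suc k) = ≡.trans (coeff-*P-suc p q k)
      (≡.trans (cong₂ _+_ (cong₂ _*_ (coeff-≡ e 0) (coeff-≡ q≈q′ (suc k)))
                          (go (tailP p) (tailP p′) (tailP-cong e) k))
               (≡.sym (coeff-*P-suc p′ q′ k)))

  *P-comm : ∀ p q → p *P q ≈ₚ q *P p
  *P-comm p q = coeffwise (go p q)
    where
    go : ∀ p q k → coeff (p *P q) k ≡ coeff (q *P p) k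
    go p q zero = begin
      coeff (p *P q) 0          ≡⟨ coeff-*P-zero p q ⟩
      coeff p 0 * coeff q 0     ≡⟨ ℤ.*-comm (coeff p 0) (coeff q 0) ⟩
      coeff q 0 * coeff p 0     ≡⟨ coeff-*P-zero q p ⟨
      coeff (q *P p) 0          ∎
    go p q (suc zero) = begin
      coeff (p *P q) 1                                  ≡⟨ coeff-*P-suc p q 0 ⟩
      p₀ * coeff q 1 + coeff (tailP p *P q) 0           ≡⟨ cong (_+_ (p₀ * coeff q 1)) (tail₀ p q) ⟩
      p₀ * coeff q 1 + coeff p 1 * q₀                   ≡⟨ swap p₀ (coeff q 1) (coeff p 1) q₀ ⟩
      q₀ * coeff p 1 + coeff q 1 * p₀                   ≡⟨ cong (_+_ (q₀ * coeff p 1)) (tail₀ q p) ⟨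
      q₀ * coeff p 1 + coeff (tailP q *P p) 0           ≡⟨ coeff-*P-suc q p 0 ⟨
      coeff (q *P p) 1                                  ∎
      where
      p₀ = coeff p 0
      q₀ = coeff q 0
      tail₀ : ∀ p q → coeff (tailP p *P q) 0 ≡ coeff p 1 * coeff q 0
      tail₀ p q = ≡.trans (coeff-*P-zero (tailP p) q) (cong (_* coeff q 0) (coeff-tailP p 0))
      swap : ∀ a b c d → a * b + c * d ≡ d * c + b * a
      swap = solve-∀
    go p q (suc (suc k)) = begin
      coeff (p *P q) (2 ℕ.+ k)
        ≡⟨ coeff-*P-suc p q (suc k) ⟩
      p₀ * coeff q (2 ℕ.+ k) + coeff (tailP p *P q) (suc k)
        ≡⟨ cong (_+_ (p₀ * coeff q (2 ℕ.+ k))) (≡.trans (go (tailP p) q (suc k)) (coeff-*P-suc q (tailP p) k)) ⟩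
      p₀ * coeff q (2 ℕ.+ k) + (q₀ * coeff (tailP p) (suc k) + coeff (tailP q *P tailP p) k)
        ≡⟨ cong₂ (λ x y → p₀ * coeff q (2 ℕ.+ k) + (q₀ * x + y))
                 (coeff-tailP p (suc k)) (go (tailP q) (tailP p) k) ⟩
      p₀ * coeff q (2 ℕ.+ k) + (q₀ * coeff p (2 ℕ.+ k) + coeff (tailP p *P tailP q) k)
        ≡⟨ exchange (p₀ * coeff q (2 ℕ.+ k)) (q₀ * coeff p (2 ℕ.+ k)) (coeff (tailP p *P tailP q) k) ⟩
      q₀ * coeff p (2 ℕ.+ k) + (p₀ * coeff q (2 ℕ.+ k) + coeff (tailP p *P tailP q) k)
        ≡⟨ cong (λ x → q₀ * coeff p (2 ℕ.+ k) + (p₀ * x + coeff (tailP p *P tailP q) k))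
                (coeff-tailP q (suc k)) ⟨
      q₀ * coeff p (2 ℕ.+ k) + (p₀ * coeff (tailP q) (suc k) + coeff (tailP p *P tailP q) k)
        ≡⟨ cong (_+_ (q₀ * coeff p (2 ℕ.+ k))) (≡.trans (go (tailP q) p (suc k)) (coeff-*P-suc p (tailP q) k)) ⟨
      q₀ * coeff p (2 ℕ.+ k) + coeff (tailP q *P p) (suc k)
        ≡⟨ coeff-*P-suc q p (suc k) ⟨
      coeff (q *P p) (2 ℕ.+ k) ∎
      where
      p₀ = coeff p 0
      q₀ = coeff q 0
      exchange : ∀ a b c → a + (b + c) ≡ b + (a + c)
      exchange = solve-∀

  tailP-+P : ∀ p q → tailP (p +P q) ≈ₚ tailP p +P tailP q
  tailP-+P []      q       = ≈ₚ-refl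
  tailP-+P (a ∷ p) []      = coeffwise λ k → ≡.sym (≡.trans (coeff-+P p [] k) (ℤ.+-identityʳ _))
  tailP-+P (a ∷ p) (b ∷ q) = ≈ₚ-refl

  tailP-*P : ∀ p q → tailP (p *P q) ≈ₚ scaleP (coeff p 0) (tailP q) +P (tailP p *P q)
  tailP-*P p q = coeffwise λ k → begin
    coeff (tailP (p *P q)) k
      ≡⟨ coeff-tailP (p *P q) k ⟩
    coeff (p *P q) (suc k)
      ≡⟨ coeff-*P-suc p q k ⟩
    coeff p 0 * coeff q (suc k) + coeff (tailP p *P q) k
      ≡⟨ cong (λ x → coeff p 0 * x + coeff (tailP p *P q) k) (coeff-tailP q k) ⟨
    coeff p 0 * coeff (tailP q) k + coeff (tailP p *P q) k
      ≡⟨ cong (_+ coeff (tailP p *P q) k) (coeff-scaleP (coeff p 0) (tailP q) k) ⟨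
    coeff (scaleP (coeff p 0) (tailP q)) k + coeff (tailP p *P q) k
      ≡⟨ coeff-+P (scaleP (coeff p 0) (tailP q)) (tailP p *P q) k ⟨
    coeff (scaleP (coeff p 0) (tailP q) +P (tailP p *P q)) k ∎

  *P-distribʳ : ∀ p q r → (p +P q) *P r ≈ₚ (p *P r) +P (q *P r)
  *P-distribʳ p q r = coeffwise (go p q)
    where
    go : ∀ p q k → coeff ((p +P q) *P r) k ≡ coeff ((p *P r) +P (q *P r)) k
    go p q zero = begin
      coeff ((p +P q) *P r) 0                       ≡⟨ coeff-*P-zero (p +P q) r ⟩
      coeff (p +P q) 0 * coeff r 0                  ≡⟨ cong (_* coeff r 0) (coeff-+P p q 0) ⟩
      (coeff p 0 + coeff q 0) * coeff r 0           ≡⟨ ℤ.*-distribʳ-+ (coeff r 0) (coeff p 0) (coeff q 0) ⟩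
      coeff p 0 * coeff r 0 + coeff q 0 * coeff r 0 ≡⟨ cong₂ _+_ (coeff-*P-zero p r) (coeff-*P-zero q r) ⟨
      coeff (p *P r) 0 + coeff (q *P r) 0           ≡⟨ coeff-+P (p *P r) (q *P r) 0 ⟨
      coeff ((p *P r) +P (q *P r)) 0                ∎
    go p q (suc k) = begin
      coeff ((p +P q) *P r) (suc k)
        ≡⟨ coeff-*P-suc (p +P q) r k ⟩
      coeff (p +P q) 0 * coeff r (suc k) + coeff (tailP (p +P q) *P r) k
        ≡⟨ cong₂ _+_ (cong (_* coeff r (suc k)) (coeff-+P p q 0))
             (≡.trans (coeff-≡ (*P-cong (tailP-+P p q) (≈ₚ-refl {r})) k) (go (tailP p) (tailP q) k)) ⟩
      (coeff p 0 + coeff q 0) * coeff r (suc k) + coeff ((tailP p *P r) +P (tailP q *P r)) k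
        ≡⟨ cong (_+_ ((coeff p 0 + coeff q 0) * coeff r (suc k))) (coeff-+P (tailP p *P r) (tailP q *P r) k) ⟩
      (coeff p 0 + coeff q 0) * coeff r (suc k) + (coeff (tailP p *P r) k + coeff (tailP q *P r) k)
        ≡⟨ regroup (coeff p 0) (coeff q 0) (coeff r (suc k)) (coeff (tailP p *P r) k) (coeff (tailP q *P r) k) ⟩
      (coeff p 0 * coeff r (suc k) + coeff (tailP p *P r) k) + (coeff q 0 * coeff r (suc k) + coeff (tailP q *P r) k)
        ≡⟨ cong₂ _+_ (coeff-*P-suc p r k) (coeff-*P-suc q r k) ⟨
      coeff (p *P r) (suc k) + coeff (q *P r) (suc k)
        ≡⟨ coeff-+P (p *P r) (q *P r) (suc k) ⟨
      coeff ((p *P r) +P (q *P r)) (suc k) ∎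
      where
      regroup : ∀ a b c x y → (a + b) * c + (x + y) ≡ (a * c + x) + (b * c + y)
      regroup = solve-∀

  scaleP-*P : ∀ a p q → scaleP a p *P q ≈ₚ scaleP a (p *P q)
  scaleP-*P a p q = coeffwise (go p)
    where
    go : ∀ p k → coeff (scaleP a p *P q) k ≡ coeff (scaleP a (p *P q)) k
    go p zero = begin
      coeff (scaleP a p *P q) 0         ≡⟨ coeff-*P-zero (scaleP a p) q ⟩
      coeff (scaleP a p) 0 * coeff q 0  ≡⟨ cong (_* coeff q 0) (coeff-scaleP a p 0) ⟩
      a * coeff p 0 * coeff q 0         ≡⟨ ℤ.*-assoc a (coeff p 0) (coeff q 0) ⟩
      a * (coeff p 0 * coeff q 0)       ≡⟨ cong (a *_) (coeff-*P-zero p q) ⟨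
      a * coeff (p *P q) 0              ≡⟨ coeff-scaleP a (p *P q) 0 ⟨
      coeff (scaleP a (p *P q)) 0       ∎
    go p (suc k) = begin
      coeff (scaleP a p *P q) (suc k)
        ≡⟨ coeff-*P-suc (scaleP a p) q k ⟩
      coeff (scaleP a p) 0 * coeff q (suc k) + coeff (tailP (scaleP a p) *P q) k
        ≡⟨ cong₂ _+_ (cong (_* coeff q (suc k)) (coeff-scaleP a p 0))
             (≡.trans (coeff-≡ (*P-cong (tailP-scaleP p) (≈ₚ-refl {q})) k)
                      (≡.trans (go (tailP p) k) (coeff-scaleP a (tailP p *P q) k))) ⟩
      a * coeff p 0 * coeff q (suc k) + a * coeff (tailP p *P q) k
        ≡⟨ factor a (coeff p 0) (coeff q (suc k)) (coeff (tailP p *P q) k) ⟩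
      a * (coeff p 0 * coeff q (suc k) + coeff (tailP p *P q) k)
        ≡⟨ cong (a *_) (coeff-*P-suc p q k) ⟨
      a * coeff (p *P q) (suc k)
        ≡⟨ coeff-scaleP a (p *P q) (suc k) ⟨
      coeff (scaleP a (p *P q)) (suc k) ∎
      where
      factor : ∀ a b c d → a * b * c + a * d ≡ a * (b * c + d)
      factor = solve-∀
      tailP-scaleP : ∀ p → tailP (scaleP a p) ≈ₚ scaleP a (tailP p)
      tailP-scaleP []      = ≈ₚ-refl
      tailP-scaleP (b ∷ p) = ≈ₚ-refl

  *P-assoc : ∀ p q r → (p *P q) *P r ≈ₚ p *P (q *P r)
  *P-assoc p q r = coeffwise (go p)
    where
    go : ∀ p k → coeff ((p *P q) *P r) k ≡ coeff (p *P (q *P r)) k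
    go p zero = begin
      coeff ((p *P q) *P r) 0                   ≡⟨ coeff-*P-zero (p *P q) r ⟩
      coeff (p *P q) 0 * coeff r 0              ≡⟨ cong (_* coeff r 0) (coeff-*P-zero p q) ⟩
      coeff p 0 * coeff q 0 * coeff r 0         ≡⟨ ℤ.*-assoc (coeff p 0) (coeff q 0) (coeff r 0) ⟩
      coeff p 0 * (coeff q 0 * coeff r 0)       ≡⟨ cong (coeff p 0 *_) (coeff-*P-zero q r) ⟨
      coeff p 0 * coeff (q *P r) 0              ≡⟨ coeff-*P-zero p (q *P r) ⟨
      coeff (p *P (q *P r)) 0                   ∎
    go p (suc k) = begin
      coeff ((p *P q) *P r) (suc k)
        ≡⟨ coeff-*P-suc (p *P q) r k ⟩
      coeff (p *P q) 0 * coeff r (suc k) + coeff (tailP (p *P q) *P r) k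
        ≡⟨ cong₂ _+_ (cong (_* coeff r (suc k)) (coeff-*P-zero p q)) tail-term ⟩
      p₀ * coeff q 0 * coeff r (suc k) + (p₀ * coeff (tailP q *P r) k + coeff (tailP p *P (q *P r)) k)
        ≡⟨ factor p₀ (coeff q 0) (coeff r (suc k)) (coeff (tailP q *P r) k) (coeff (tailP p *P (q *P r)) k) ⟩
      p₀ * (coeff q 0 * coeff r (suc k) + coeff (tailP q *P r) k) + coeff (tailP p *P (q *P r)) k
        ≡⟨ cong (λ x → p₀ * x + coeff (tailP p *P (q *P r)) k) (coeff-*P-suc q r k) ⟨
      p₀ * coeff (q *P r) (suc k) + coeff (tailP p *P (q *P r)) k
        ≡⟨ coeff-*P-suc p (q *P r) k ⟨
      coeff (p *P (q *P r)) (suc k) ∎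
      where
      p₀ = coeff p 0
      factor : ∀ a b c d e → a * b * c + (a * d + e) ≡ a * (b * c + d) + e
      factor = solve-∀
      tail-term : coeff (tailP (p *P q) *P r) k ≡ p₀ * coeff (tailP q *P r) k + coeff (tailP p *P (q *P r)) k
      tail-term = begin
        coeff (tailP (p *P q) *P r) k
          ≡⟨ coeff-≡ (*P-cong (tailP-*P p q) (≈ₚ-refl {r})) k ⟩
        coeff ((scaleP p₀ (tailP q) +P (tailP p *P q)) *P r) k
          ≡⟨ coeff-≡ (*P-distribʳ (scaleP p₀ (tailP q)) (tailP p *P q) r) k ⟩
        coeff ((scaleP p₀ (tailP q) *P r) +P ((tailP p *P q) *P r)) k
          ≡⟨ coeff-+P (scaleP p₀ (tailP q) *P r) ((tailP p *P q) *P r) k ⟩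
        coeff (scaleP p₀ (tailP q) *P r) k + coeff ((tailP p *P q) *P r) k
          ≡⟨ cong₂ _+_ (≡.trans (coeff-≡ (scaleP-*P p₀ (tailP q) r) k) (coeff-scaleP p₀ (tailP q *P r) k))
                       (go (tailP p) k) ⟩
        p₀ * coeff (tailP q *P r) k + coeff (tailP p *P (q *P r)) k ∎

  *P-identityˡ : ∀ p → (+ 1 ∷ []) *P p ≈ₚ p
  *P-identityˡ p = coeffwise λ k → begin
    coeff (scaleP (+ 1) p +P (+ 0 ∷ [])) k      ≡⟨ coeff-+P (scaleP (+ 1) p) (+ 0 ∷ []) k ⟩
    coeff (scaleP (+ 1) p) k + coeff (+ 0 ∷ []) k
      ≡⟨ cong₂ _+_ (≡.trans (coeff-scaleP (+ 1) p k) (ℤ.*-identityˡ _)) (zero-coeff k) ⟩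
    coeff p k + + 0                             ≡⟨ ℤ.+-identityʳ _ ⟩
    coeff p k                                   ∎
    where
    zero-coeff : ∀ k → coeff (+ 0 ∷ []) k ≡ + 0
    zero-coeff zero    = refl
    zero-coeff (suc k) = refl

  +P-assoc : ∀ p q r → (p +P q) +P r ≈ₚ p +P (q +P r)
  +P-assoc p q r = coeffwise λ k → begin
    coeff ((p +P q) +P r) k                ≡⟨ coeff-+P (p +P q) r k ⟩
    coeff (p +P q) k + coeff r k           ≡⟨ cong (_+ coeff r k) (coeff-+P p q k) ⟩
    coeff p k + coeff q k + coeff r k      ≡⟨ ℤ.+-assoc (coeff p k) (coeff q k) (coeff r k) ⟩
    coeff p k + (coeff q k + coeff r k)    ≡⟨ cong (_+_ (coeff p k)) (coeff-+P q r k) ⟨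
    coeff p k + coeff (q +P r) k           ≡⟨ coeff-+P p (q +P r) k ⟨
    coeff (p +P (q +P r)) k                ∎

  +P-comm : ∀ p q → p +P q ≈ₚ q +P p
  +P-comm p q = coeffwise λ k →
    ≡.trans (coeff-+P p q k) (≡.trans (ℤ.+-comm (coeff p k) (coeff q k)) (≡.sym (coeff-+P q p k)))

  +P-identityʳ : ∀ p → p +P [] ≈ₚ p
  +P-identityʳ p = coeffwise λ k → ≡.trans (coeff-+P p [] k) (ℤ.+-identityʳ _)

  negP-cong : ∀ {p q} → p ≈ₚ q → negP p ≈ₚ negP q
  negP-cong {p} {q} p≈q = coeffwise λ k →
    ≡.trans (coeff-negP p k) (≡.trans (cong -_ (coeff-≡ p≈q k)) (≡.sym (coeff-negP q k)))

  +P-inverseˡ : ∀ p → negP p +P p ≈ₚ []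
  +P-inverseˡ p = coeffwise λ k →
    ≡.trans (coeff-+P (negP p) p k) (≡.trans (cong (_+ coeff p k) (coeff-negP p k)) (ℤ.+-inverseˡ (coeff p k)))

  +P-inverseʳ : ∀ p → p +P negP p ≈ₚ []
  +P-inverseʳ p = ≈ₚ-trans (+P-comm p (negP p)) (+P-inverseˡ p)

  *P-identityʳ : ∀ p → p *P (+ 1 ∷ []) ≈ₚ p
  *P-identityʳ p = ≈ₚ-trans (*P-comm p (+ 1 ∷ [])) (*P-identityˡ p)

  *P-distribˡ : ∀ p q r → p *P (q +P r) ≈ₚ (p *P q) +P (p *P r)
  *P-distribˡ p q r =
    ≈ₚ-trans (*P-comm p (q +P r)) (≈ₚ-trans (*P-distribʳ q r p) (+P-cong (*P-comm q p) (*P-comm r p)))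

  ℤ[X]-isCommutativeRing : IsCommutativeRing _≈ₚ_ _+P_ _*P_ negP [] (+ 1 ∷ [])
  ℤ[X]-isCommutativeRing = record
    { isRing = record
      { +-isAbelianGroup = record
        { isGroup = record
          { isMonoid = record
            { isSemigroup = record
              { isMagma = record
                { isEquivalence = record { refl = ≈ₚ-refl ; sym = ≈ₚ-sym ; trans = ≈ₚ-trans }
                ; ∙-cong = +P-cong }
              ; assoc = +P-assoc }
            ; identity = (λ p → ≈ₚ-refl) , +P-identityʳ }
          ; inverse = +P-inverseˡ , +P-inverseʳ
          ; ⁻¹-cong = negP-cong }
        ; comm = +P-comm }
      ; *-cong = *P-cong
      ; *-assoc = *P-assoc
      ; *-identity = *P-identityˡ , *P-identityʳ
      ; distrib = *P-distribˡ , λ r p q → *P-distribʳ p q r }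
    ; *-comm = *P-comm }

  ℤ[X]-commutativeRing : CommutativeRing _ _
  ℤ[X]-commutativeRing = record { isCommutativeRing = ℤ[X]-isCommutativeRing }

open Polynomials

import Relation.Binary.Reasoning.Setoid
module ℤ[X] = CommutativeRing ℤ[X]-commutativeRing
module ≈ₚ-Reasoning = Relation.Binary.Reasoning.Setoid ℤ[X].setoid
open Determinant ℤ[X]-commutativeRing

module CharacteristicPolynomials where

  open import Data.Bool using (if_then_else_)
  open import Data.Fin using (Fin; zero; suc; toℕ)
  open import Data.Integer using (ℤ; +_; -_; _+_; _*_)
  import Data.Integer.Properties as ℤ
  open import Data.List using ([]; _∷_)
  open import Data.Nat using (zero; suc)
  open import Function using (_∘_)
  open import Function.Bundles using (_⇔_; mk⇔)
  open import Relation.Binary.PropositionalEquality as ≡ using (_≡_; refl; cong)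

  const : ℤ → Poly
  const a = a ∷ []

  X : Poly
  X = + 0 ∷ + 1 ∷ []

  const-zero : const (+ 0) ≈ₚ []
  const-zero = coeffwise λ { zero → refl ; (suc k) → refl }

  const-* : ∀ a b → const (a * b) ≈ₚ const a *P const b
  const-* a b = coeffwise λ { zero → ≡.sym (ℤ.+-identityʳ (a * b)) ; (suc k) → refl }

  scaleP≈const-*P : ∀ a p → scaleP a p ≈ₚ const a *P p
  scaleP≈const-*P a p = coeffwise λ k → ≡.sym (≡.trans (coeff-+P (scaleP a p) (+ 0 ∷ []) k) (zero-tail k))
    where
    zero-tail : ∀ k → coeff (scaleP a p) k + coeff (+ 0 ∷ []) k ≡ coeff (scaleP a p) k
    zero-tail zero    = ℤ.+-identityʳ _
    zero-tail (suc k) = ℤ.+-identityʳ _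

  sign≈const : ∀ k → sign k ≈ₚ const (Defs.sign k)
  sign≈const zero    = ≈ₚ-refl
  sign≈const (suc k) = coeffwise λ i →
    ≡.trans (coeff-negP (sign k) i) (≡.trans (cong -_ (coeff-≡ (sign≈const k) i)) (negated i))
    where
    negated : ∀ i → - coeff (const (Defs.sign k)) i ≡ coeff (const (- Defs.sign k)) i
    negated zero    = refl
    negated (suc i) = refl

  det≈ : ∀ {n} (M : Fin n → Fin n → Poly) → Defs.det M ≈ₚ det M
  det≈ {zero}  M = ≈ₚ-refl
  det≈ {suc n} M = sumP≈sum λ j →
    ≈ₚ-trans (scaleP≈const-*P (Defs.sign (toℕ j)) (M zero j *P Defs.det (minor j M)))
             (ℤ[X].*-cong (≈ₚ-sym (sign≈const (toℕ j))) (ℤ[X].*-congˡ {M zero j} (det≈ (minor j M))))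
    where
    sumP≈sum : ∀ {m} {f g : Fin m → Poly} → (∀ i → f i ≈ₚ g i) → sumP f ≈ₚ sum g
    sumP≈sum {zero}  f≈g = ≈ₚ-refl
    sumP≈sum {suc m} f≈g = +P-cong (f≈g zero) (sumP≈sum (f≈g ∘ suc))

  charMatrix : ∀ {n} → Mat n → Matrix n
  charMatrix M i j = (if eqB i j then X else []) +P const (- M i j)

  χ : ∀ {n} → Mat n → Poly
  χ M = det (charMatrix M)

  χ-cong : ∀ {n} {M N : Mat n} → (∀ i j → M i j ≡ N i j) → χ M ≈ₚ χ N
  χ-cong M≡N = det-cong λ i j → ≈ₚ-reflexive (cong (λ m → (if eqB i j then X else []) +P const (- m)) (M≡N i j))

  cospectral⇔χ≈ : ∀ {n m} (M : Mat n) (N : Mat m) → Cospectral M N ⇔ χ M ≈ₚ χ N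
  cospectral⇔χ≈ M N = mk⇔
    (λ M~N → ≈ₚ-trans (≈ₚ-sym (det≈ (charMatrix M))) (≈ₚ-trans (coeffwise M~N) (det≈ (charMatrix N))))
    (λ χ≈ → coeff-≡ (≈ₚ-trans (det≈ (charMatrix M)) (≈ₚ-trans χ≈ (≈ₚ-sym (det≈ (charMatrix N))))))

open CharacteristicPolynomials

module Substitution where

  open import Algebra.Morphism.Structures using (IsRingHomomorphism)
  open import Data.Integer using (+_; -_; _+_; _*_)
  import Data.Integer.Properties as ℤ
  open import Data.List using ([]; _∷_)
  open import Data.Nat using (zero; suc)
  open import Function using (_∘_)
  open import Relation.Binary.PropositionalEquality as ≡ using (_≡_; refl; cong)
  open import Algebra.Solver.Ring.NaturalCoefficients.Default ℤ[X].commutativeSemiring using (solve; _:+_; _:*_; _:=_)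

  infixl 30 _∘ₚ_
  _∘ₚ_ : Poly → Poly → Poly
  []      ∘ₚ r = []
  (a ∷ p) ∘ₚ r = const a +P (r *P (p ∘ₚ r))

  ∘ₚ-zero : ∀ r {q} → q ≈ₚ [] → q ∘ₚ r ≈ₚ []
  ∘ₚ-zero r {[]}    q≈0 = ≈ₚ-refl
  ∘ₚ-zero r {b ∷ q} q≈0 = begin
    const b +P (r *P (q ∘ₚ r))
      ≈⟨ +P-cong (≈ₚ-trans (≈ₚ-reflexive (cong const (coeff-≡ q≈0 0))) const-zero)
                 (ℤ[X].*-congˡ {r} (∘ₚ-zero r {q} (coeffwise (coeff-≡ q≈0 ∘ suc)))) ⟩
    [] +P (r *P [])  ≈⟨ ℤ[X].zeroʳ r ⟩
    [] ∎
    where open ≈ₚ-Reasoning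

  ∘ₚ-congˡ : ∀ r {p q} → p ≈ₚ q → p ∘ₚ r ≈ₚ q ∘ₚ r
  ∘ₚ-congˡ r {[]}    {q}     p≈q = ≈ₚ-sym (∘ₚ-zero r (≈ₚ-sym p≈q))
  ∘ₚ-congˡ r {a ∷ p} {[]}    p≈q = ∘ₚ-zero r p≈q
  ∘ₚ-congˡ r {a ∷ p} {b ∷ q} p≈q = +P-cong (≈ₚ-reflexive (cong const (coeff-≡ p≈q 0)))
    (ℤ[X].*-congˡ {r} (∘ₚ-congˡ r {p} {q} (coeffwise (coeff-≡ p≈q ∘ suc))))

  ∘ₚ-congʳ : ∀ p {r s} → r ≈ₚ s → p ∘ₚ r ≈ₚ p ∘ₚ s
  ∘ₚ-congʳ []      r≈s = ≈ₚ-refl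
  ∘ₚ-congʳ (a ∷ p) r≈s = +P-cong (≈ₚ-refl {const a}) (*P-cong r≈s (∘ₚ-congʳ p r≈s))

  ∘ₚ-+P : ∀ r p q → (p +P q) ∘ₚ r ≈ₚ p ∘ₚ r +P q ∘ₚ r
  ∘ₚ-+P r []      q       = ≈ₚ-refl
  ∘ₚ-+P r (a ∷ p) []      = ≈ₚ-sym (ℤ[X].+-identityʳ ((a ∷ p) ∘ₚ r))
  ∘ₚ-+P r (a ∷ p) (b ∷ q) = begin
    const (a + b) +P (r *P (p +P q) ∘ₚ r)
      ≈⟨ +P-cong (≈ₚ-refl {const a +P const b}) (ℤ[X].*-congˡ {r} (∘ₚ-+P r p q)) ⟩
    (const a +P const b) +P (r *P (p ∘ₚ r +P q ∘ₚ r))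
      ≈⟨ solve 5 (λ x y z u v → (x :+ y) :+ (z :* (u :+ v)) := (x :+ z :* u) :+ (y :+ z :* v))
           ℤ[X].refl (const a) (const b) r (p ∘ₚ r) (q ∘ₚ r) ⟩
    (const a +P (r *P p ∘ₚ r)) +P (const b +P (r *P q ∘ₚ r)) ∎
    where open ≈ₚ-Reasoning

  ∘ₚ-scaleP : ∀ r a p → scaleP a p ∘ₚ r ≈ₚ const a *P p ∘ₚ r
  ∘ₚ-scaleP r a []      = ≈ₚ-sym (ℤ[X].zeroʳ (const a))
  ∘ₚ-scaleP r a (b ∷ p) = begin
    const (a * b) +P (r *P scaleP a p ∘ₚ r)
      ≈⟨ +P-cong (const-* a b) (ℤ[X].*-congˡ {r} (∘ₚ-scaleP r a p)) ⟩
    (const a *P const b) +P (r *P (const a *P p ∘ₚ r))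
      ≈⟨ solve 4 (λ x y z u → (x :* y) :+ (z :* (x :* u)) := x :* (y :+ z :* u)) ℤ[X].refl
               (const a) (const b) r (p ∘ₚ r) ⟩
    const a *P (const b +P (r *P p ∘ₚ r)) ∎
    where open ≈ₚ-Reasoning

  ∘ₚ-*P : ∀ r p q → (p *P q) ∘ₚ r ≈ₚ p ∘ₚ r *P q ∘ₚ r
  ∘ₚ-*P r []      q = ≈ₚ-sym (ℤ[X].zeroˡ (q ∘ₚ r))
  ∘ₚ-*P r (a ∷ p) q = begin
    (scaleP a q +P (+ 0 ∷ (p *P q))) ∘ₚ r
      ≈⟨ ∘ₚ-+P r (scaleP a q) (+ 0 ∷ (p *P q)) ⟩
    scaleP a q ∘ₚ r +P (const (+ 0) +P (r *P (p *P q) ∘ₚ r))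
      ≈⟨ +P-cong (∘ₚ-scaleP r a q) (+P-cong const-zero (ℤ[X].*-congˡ {r} (∘ₚ-*P r p q))) ⟩
    (const a *P q ∘ₚ r) +P ([] +P (r *P (p ∘ₚ r *P q ∘ₚ r)))
      ≈⟨ solve 4 (λ x y z u → (x :* y) :+ (z :* (u :* y)) := (x :+ z :* u) :* y) ℤ[X].refl
               (const a) (q ∘ₚ r) r (p ∘ₚ r) ⟩
    (const a +P (r *P p ∘ₚ r)) *P q ∘ₚ r ∎
    where open ≈ₚ-Reasoning

  const-∘ₚ : ∀ r a → const a ∘ₚ r ≈ₚ const a
  const-∘ₚ r a = ≈ₚ-trans (+P-cong (≈ₚ-refl {const a}) (ℤ[X].zeroʳ r)) (ℤ[X].+-identityʳ (const a))

  X-∘ₚ : ∀ r → X ∘ₚ r ≈ₚ r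
  X-∘ₚ r = begin
    const (+ 0) +P (r *P (const (+ 1) +P (r *P [])))
      ≈⟨ +P-cong const-zero (ℤ[X].*-congˡ {r} (const-∘ₚ r (+ 1))) ⟩
    [] +P (r *P const (+ 1))  ≈⟨ ℤ[X].*-identityʳ r ⟩
    r ∎
    where open ≈ₚ-Reasoning

  ∘ₚ-negP : ∀ r p → negP p ∘ₚ r ≈ₚ negP (p ∘ₚ r)
  ∘ₚ-negP r p = begin
    negP p ∘ₚ r                      ≈⟨ ∘ₚ-congˡ r (negP≈ p) ⟩
    (const (- + 1) *P p) ∘ₚ r        ≈⟨ ∘ₚ-*P r (const (- + 1)) p ⟩
    const (- + 1) ∘ₚ r *P p ∘ₚ r     ≈⟨ ℤ[X].*-congʳ (const-∘ₚ r (- + 1)) ⟩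
    const (- + 1) *P p ∘ₚ r          ≈⟨ negP≈ (p ∘ₚ r) ⟨
    negP (p ∘ₚ r) ∎
    where
    open ≈ₚ-Reasoning
    negP≈ : ∀ p → negP p ≈ₚ const (- + 1) *P p
    negP≈ p = coeffwise λ k → ≡.trans (coeff-negP p k) (≡.sym
      (≡.trans (coeff-≡ (≈ₚ-sym (scaleP≈const-*P (- + 1) p)) k)
               (≡.trans (coeff-scaleP (- + 1) p k) (ℤ.-1*i≡-i (coeff p k)))))

  ∘ₚ-assoc : ∀ p r s → (p ∘ₚ r) ∘ₚ s ≈ₚ p ∘ₚ (r ∘ₚ s)
  ∘ₚ-assoc []      r s = ≈ₚ-refl
  ∘ₚ-assoc (a ∷ p) r s = begin
    (const a +P (r *P p ∘ₚ r)) ∘ₚ s       ≈⟨ ∘ₚ-+P s (const a) (r *P p ∘ₚ r) ⟩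
    const a ∘ₚ s +P (r *P p ∘ₚ r) ∘ₚ s
      ≈⟨ +P-cong (const-∘ₚ s a) (≈ₚ-trans (∘ₚ-*P s r (p ∘ₚ r)) (ℤ[X].*-congˡ {r ∘ₚ s} (∘ₚ-assoc p r s))) ⟩
    const a +P (r ∘ₚ s *P p ∘ₚ (r ∘ₚ s)) ∎
    where open ≈ₚ-Reasoning

  ∘ₚ-X : ∀ p → p ∘ₚ X ≈ₚ p
  ∘ₚ-X []      = ≈ₚ-refl
  ∘ₚ-X (a ∷ p) = begin
    const a +P (X *P p ∘ₚ X)
      ≈⟨ +P-cong (≈ₚ-refl {const a}) (≈ₚ-trans (X-*P (p ∘ₚ X)) (coeffwise {+ 0 ∷ p ∘ₚ X} {+ 0 ∷ p} shifted)) ⟩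
    const a +P (+ 0 ∷ p)      ≈⟨ coeffwise (λ { zero → ℤ.+-identityʳ a ; (suc k) → refl }) ⟩
    a ∷ p ∎
    where
    open ≈ₚ-Reasoning
    X-*P : ∀ q → X *P q ≈ₚ + 0 ∷ q
    X-*P q = coeffwise λ
      { zero    → ≡.trans (coeff-*P-zero X q) (ℤ.*-zeroˡ (coeff q 0))
      ; (suc k) → ≡.trans (coeff-*P-suc X q k)
                    (≡.trans (cong (_+ coeff ((+ 1 ∷ []) *P q) k) (ℤ.*-zeroˡ (coeff q (suc k))))
                             (≡.trans (ℤ.+-identityˡ _) (coeff-≡ (*P-identityˡ q) k))) }
    shifted : ∀ k → coeff (+ 0 ∷ p ∘ₚ X) k ≡ coeff (+ 0 ∷ p) k
    shifted zero    = refl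
    shifted (suc k) = coeff-≡ (∘ₚ-X p) k

  ∘ₚ-isRingHomomorphism : ∀ r → IsRingHomomorphism ℤ[X].rawRing ℤ[X].rawRing (_∘ₚ r)
  ∘ₚ-isRingHomomorphism r = record
    { isSemiringHomomorphism = record
      { isNearSemiringHomomorphism = record
        { +-isMonoidHomomorphism = record
          { isMagmaHomomorphism = record
            { isRelHomomorphism = record { cong = ∘ₚ-congˡ r }
            ; homo = λ p q → ∘ₚ-+P r p q }
          ; ε-homo = ≈ₚ-refl }
        ; *-homo = λ p q → ∘ₚ-*P r p q }
      ; 1#-homo = const-∘ₚ r (+ 1) }
    ; -‿homo = ∘ₚ-negP r }

  ∘ₚ-cancelʳ : ∀ r r′ → r ∘ₚ r′ ≈ₚ X → ∀ {p q} → p ∘ₚ r ≈ₚ q ∘ₚ r → p ≈ₚ q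
  ∘ₚ-cancelʳ r r′ r∘r′≈X {p} {q} p∘r≈q∘r = begin
    p                  ≈⟨ undo p ⟨
    (p ∘ₚ r) ∘ₚ r′     ≈⟨ ∘ₚ-congˡ r′ p∘r≈q∘r ⟩
    (q ∘ₚ r) ∘ₚ r′     ≈⟨ undo q ⟩
    q ∎
    where
    open ≈ₚ-Reasoning
    undo : ∀ p → (p ∘ₚ r) ∘ₚ r′ ≈ₚ p
    undo p = ≈ₚ-trans (∘ₚ-assoc p r r′) (≈ₚ-trans (∘ₚ-congʳ p r∘r′≈X) (∘ₚ-X p))

open Substitution

module Degrees where

  open import Data.Bool using (true; false; if_then_else_)
  open import Data.Fin using (Fin; zero; suc; toℕ; punchIn)
  import Data.Fin.Properties as Fin
  open import Data.Integer using (+_; -_; _+_; _*_)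
  import Data.Integer.Properties as ℤ
  open import Data.List using ([])
  open import Data.Nat using (ℕ; zero; suc; z≤n; s≤s)
  import Data.Nat as ℕ
  import Data.Nat.Properties as ℕ
  open import Function using (_∘_)
  open import Function.Bundles using (Equivalence)
  open Equivalence using (to)
  open import Relation.Binary.Definitions using (tri<; tri≈; tri>)
  open import Relation.Binary.PropositionalEquality as ≡ using (_≡_; _≢_; refl; cong; cong₂)
  open import Relation.Nullary using (¬_)
  open import Relation.Nullary.Negation using (contradiction)
  open ≡.≡-Reasoning

  record Deg≤ (p : Poly) (d : ℕ) : Set where
    constructor vanishingAbove
    field coeff-vanishes : ∀ k → d ℕ.< k → coeff p k ≡ + 0
  open Deg≤

  Deg≤-cong : ∀ {p q d} → p ≈ₚ q → Deg≤ p d → Deg≤ q d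
  Deg≤-cong p≈q p≤d = vanishingAbove λ k d<k → ≡.trans (≡.sym (coeff-≡ p≈q k)) (coeff-vanishes p≤d k d<k)

  Deg≤-mono : ∀ {p d e} → d ℕ.≤ e → Deg≤ p d → Deg≤ p e
  Deg≤-mono d≤e p≤d = vanishingAbove λ k e<k → coeff-vanishes p≤d k (ℕ.≤-<-trans d≤e e<k)

  Deg≤-+P : ∀ {p q d} → Deg≤ p d → Deg≤ q d → Deg≤ (p +P q) d
  Deg≤-+P {p} {q} p≤d q≤d = vanishingAbove λ k d<k →
    ≡.trans (coeff-+P p q k) (cong₂ _+_ (coeff-vanishes p≤d k d<k) (coeff-vanishes q≤d k d<k))

  Deg≤-const : ∀ a → Deg≤ (const a) 0
  Deg≤-const a = vanishingAbove λ { (suc k) _ → refl }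

  Deg≤-tailP : ∀ {p d} → Deg≤ p (suc d) → Deg≤ (tailP p) d
  Deg≤-tailP {p} p≤d = vanishingAbove λ k d<k → ≡.trans (coeff-tailP p k) (coeff-vanishes p≤d (suc k) (s≤s d<k))

  coeff-*P-constant : ∀ {p} q → Deg≤ p 0 → ∀ k → coeff (p *P q) k ≡ coeff p 0 * coeff q k
  coeff-*P-constant {p} q p≤0 zero    = coeff-*P-zero p q
  coeff-*P-constant {p} q p≤0 (suc k) = begin
    coeff (p *P q) (suc k)                                ≡⟨ coeff-*P-suc p q k ⟩
    coeff p 0 * coeff q (suc k) + coeff (tailP p *P q) k
      ≡⟨ cong (_+_ (coeff p 0 * coeff q (suc k))) (coeff-≡ (*P-cong tailP≈0 (≈ₚ-refl {q})) k) ⟩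
    coeff p 0 * coeff q (suc k) + + 0                     ≡⟨ ℤ.+-identityʳ _ ⟩
    coeff p 0 * coeff q (suc k)                           ∎
    where
    tailP≈0 : tailP p ≈ₚ []
    tailP≈0 = coeffwise λ k → ≡.trans (coeff-tailP p k) (coeff-vanishes p≤0 (suc k) (s≤s z≤n))

  Deg≤-*P : ∀ {p q} d e → Deg≤ p d → Deg≤ q e → Deg≤ (p *P q) (d ℕ.+ e)
  Deg≤-*P {p} {q} zero e p≤0 q≤e = vanishingAbove λ k e<k →
    ≡.trans (coeff-*P-constant q p≤0 k)
            (≡.trans (cong (coeff p 0 *_) (coeff-vanishes q≤e k e<k)) (ℤ.*-zeroʳ (coeff p 0)))
  Deg≤-*P {p} {q} (suc d) e p≤d q≤e = vanishingAbove λ { (suc k) (s≤s d+e<k) → ≡.trans (coeff-*P-suc p q k)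
    (cong₂ _+_ (≡.trans (cong (coeff p 0 *_)
                                (coeff-vanishes q≤e (suc k) (s≤s (ℕ.≤-trans (ℕ.m≤n+m e d) (ℕ.<⇒≤ d+e<k)))))
                        (ℤ.*-zeroʳ (coeff p 0)))
               (coeff-vanishes (Deg≤-*P d e (Deg≤-tailP p≤d) q≤e) k d+e<k)) }

  coeff-*P-top : ∀ {p q} d e → Deg≤ p d → Deg≤ q e → coeff (p *P q) (d ℕ.+ e) ≡ coeff p d * coeff q e
  coeff-*P-top {p} {q} zero    e p≤0 q≤e = coeff-*P-constant q p≤0 e
  coeff-*P-top {p} {q} (suc d) e p≤d q≤e = ≡.trans (coeff-*P-suc p q (d ℕ.+ e))
    (≡.trans (cong₂ _+_ (≡.trans (cong (coeff p 0 *_) (coeff-vanishes q≤e (suc (d ℕ.+ e)) (s≤s (ℕ.m≤n+m e d))))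
                                 (ℤ.*-zeroʳ (coeff p 0)))
                        (≡.trans (coeff-*P-top d e (Deg≤-tailP p≤d) q≤e) (cong (_* coeff q e) (coeff-tailP p d))))
             (ℤ.+-identityˡ _))

  Deg≤-sum : ∀ {n d} (f : Fin n → Poly) → (∀ i → Deg≤ (f i) d) → Deg≤ (sum f) d
  Deg≤-sum {zero}  f f≤d = vanishingAbove λ k _ → refl
  Deg≤-sum {suc n} f f≤d = Deg≤-+P (f≤d zero) (Deg≤-sum (f ∘ suc) (f≤d ∘ suc))

  Deg≤-sign : ∀ k → Deg≤ (sign k) 0
  Deg≤-sign k = Deg≤-cong (≈ₚ-sym (sign≈const k)) (Deg≤-const (Defs.sign k))

  Deg≤-det : ∀ {n} (M : Matrix n) → (∀ i j → Deg≤ (M i j) 1) → Deg≤ (det M) n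
  Deg≤-det {zero}  M M≤1 = Deg≤-const (+ 1)
  Deg≤-det {suc n} M M≤1 = Deg≤-sum (laplaceTerm M) λ j → Deg≤-*P 0 (suc n) (Deg≤-sign (toℕ j))
    (Deg≤-*P 1 n (M≤1 zero j) (Deg≤-det (minor j M) λ i k → M≤1 (suc i) (punchIn j k)))

  Deg≤-det-constantRow : ∀ {n} (M : Matrix n) (r : Fin n) → (∀ i j → Deg≤ (M i j) 1) →
    (∀ j → Deg≤ (M r j) 0) → Deg≤ (det M) (ℕ.pred n)
  Deg≤-det-constantRow {suc n} M zero M≤1 r≤0 =
    Deg≤-sum (laplaceTerm M) λ j → Deg≤-*P 0 n (Deg≤-sign (toℕ j))
    (Deg≤-*P 0 n (r≤0 j) (Deg≤-det (minor j M) λ i k → M≤1 (suc i) (punchIn j k)))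
  Deg≤-det-constantRow {suc (suc n)} M (suc r) M≤1 r≤0 =
    Deg≤-sum (laplaceTerm M) λ j → Deg≤-*P 0 (suc n) (Deg≤-sign (toℕ j)) (Deg≤-*P 1 n (M≤1 zero j)
      (Deg≤-det-constantRow (minor j M) r (λ i k → M≤1 (suc i) (punchIn j k)) (r≤0 ∘ punchIn j)))

  entry-Deg≤1 : ∀ b m → Deg≤ ((if b then X else []) +P const m) 1
  entry-Deg≤1 true  m = vanishingAbove λ { (suc zero) (s≤s ()) ; (suc (suc k)) _ → refl }
  entry-Deg≤1 false m = vanishingAbove λ { (suc zero) (s≤s ()) ; (suc (suc k)) _ → refl }

  charMatrix-Deg≤1 : ∀ {n} (M : Mat n) i j → Deg≤ (charMatrix M i j) 1
  charMatrix-Deg≤1 M i j = entry-Deg≤1 (eqB i j) (- M i j)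

  charMatrix-offDiagonal : ∀ {n} (M : Mat n) {i j} → i ≢ j → Deg≤ (charMatrix M i j) 0
  charMatrix-offDiagonal M {i} {j} i≢j rewrite eqB-≢ i≢j = Deg≤-const (- M i j)

  minor-charMatrix : ∀ {n} (M : Mat (suc n)) → minor zero (charMatrix M) ≈ₘ charMatrix (λ i k → M (suc i) (suc k))
  minor-charMatrix M i k rewrite eqB-suc i k = ≈ₚ-refl

  χ-degree : ∀ {n} (M : Mat n) → Deg≤ (χ M) n
  χ-degree M = Deg≤-det (charMatrix M) (charMatrix-Deg≤1 M)

  χ-monic : ∀ {n} (M : Mat n) → coeff (χ M) n ≡ + 1
  χ-monic {zero}  M = refl
  χ-monic {suc n} M = begin
    coeff (laplaceTerm C zero +P sum (laplaceTerm C ∘ suc)) (suc n)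
      ≡⟨ coeff-+P (laplaceTerm C zero) (sum (laplaceTerm C ∘ suc)) (suc n) ⟩
    coeff (laplaceTerm C zero) (suc n) + coeff (sum (laplaceTerm C ∘ suc)) (suc n)
      ≡⟨ cong₂ _+_ diagonal-term other-terms ⟩
    + 1 ∎
    where
    C = charMatrix M
    diagonal-term : coeff (laplaceTerm C zero) (suc n) ≡ + 1
    diagonal-term = begin
      coeff (laplaceTerm C zero) (suc n)
        ≡⟨ coeff-≡ (*P-identityˡ (C zero zero *P det (minor zero C))) (suc n) ⟩
      coeff (C zero zero *P det (minor zero C)) (suc n)
        ≡⟨ coeff-*P-top 1 n (charMatrix-Deg≤1 M zero zero)
             (Deg≤-det (minor zero C) λ i k → charMatrix-Deg≤1 M (suc i) (suc k)) ⟩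
      + 1 * coeff (det (minor zero C)) n
        ≡⟨ cong (+ 1 *_) (≡.trans (coeff-≡ (det-cong (minor-charMatrix M)) n) (χ-monic (λ i k → M (suc i) (suc k)))) ⟩
      + 1 ∎
    other-terms : coeff (sum (laplaceTerm C ∘ suc)) (suc n) ≡ + 0
    other-terms = coeff-vanishes (Deg≤-sum (laplaceTerm C ∘ suc) (λ j → Deg≤-mono ℕ.pred[n]≤n
      (Deg≤-*P 0 (ℕ.pred n) (Deg≤-sign (toℕ (suc j)))
        (Deg≤-*P 0 (ℕ.pred n) (charMatrix-offDiagonal M {zero} {suc j} λ ())
        (Deg≤-det-constantRow (minor (suc j) C) j (λ i k → charMatrix-Deg≤1 M (suc i) (punchIn (suc j) k))
          λ k → charMatrix-offDiagonal M (Fin.punchInᵢ≢i (suc j) k ∘ ≡.sym))))))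
      (suc n) (ℕ.n<1+n n)

  χ-≉-higherOrder : ∀ {n m} (M : Mat n) (N : Mat m) → n ℕ.< m → ¬ χ M ≈ₚ χ N
  χ-≉-higherOrder {m = m} M N n<m χM≈χN
    with ≡.trans (≡.sym (coeff-vanishes (χ-degree M) m n<m)) (≡.trans (coeff-≡ χM≈χN m) (χ-monic N))
  ... | ()

  cospectral⇒sameOrder : ∀ {n m} (M : Mat n) (N : Mat m) → Cospectral M N → n ≡ m
  cospectral⇒sameOrder {n} {m} M N M~N with ℕ.<-cmp n m
  ... | tri< n<m _ _ = contradiction (to (cospectral⇔χ≈ M N) M~N) (χ-≉-higherOrder M N n<m)
  ... | tri≈ _ n≡m _ = n≡m
  ... | tri> _ _ m<n = contradiction (≈ₚ-sym (to (cospectral⇔χ≈ M N) M~N)) (χ-≉-higherOrder N M m<n)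

open Degrees

module AffineTransformations where

  open import Algebra.Properties.Semiring.Sum ℤ[X].semiring using (*-distribˡ-sum)
  open import Data.Bool using (true; false; if_then_else_)
  open import Data.Integer using (ℤ; +_; -_; _+_; _*_; _-_; ≢-nonZero)
  import Data.Integer.Properties as ℤ
  open import Data.Integer.Tactic.RingSolver using (solve-∀)
  open import Data.List using ([]; _∷_)
  open import Data.Nat using (zero; suc)
  open import Data.Product using (_×_; _,_)
  open import Function using (_∘_)
  open import Function.Bundles using (_⇔_; mk⇔; Equivalence)
  open import Relation.Binary.PropositionalEquality as ≡ using (_≡_; _≢_; refl; cong; cong₂)
  open Equivalence using (to; from)

  infixl 6 _+J_
  _+J_ : ∀ {n} → Mat n → ℤ → Mat n
  (M +J t) i j = M i j + t

  Iₘ : ∀ {n} → Mat n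
  Iₘ i j = if eqB i j then + 1 else + 0

  scalar : ∀ {n} → ℤ → Mat n
  scalar c i j = c * Iₘ i j

  -- the polynomial 1ᵀ adj(xI − M) 1
  cofactorSum : ∀ {n} → Mat n → Poly
  cofactorSum M = sum (λ i → det (replaceRow i (λ _ → const (+ 1)) (charMatrix M)))

  χ-+J : ∀ {n} (M : Mat n) t → χ (M +J t) ≈ₚ χ M +P (const (- t) *P cofactorSum M)
  χ-+J M t = begin
    χ (M +J t)                                                  ≈⟨ det-cong entrywise ⟩
    det (λ i k → charMatrix M i k +P (const (- t) *P const (+ 1)))
      ≈⟨ det-rankOneUpdate (charMatrix M) (λ _ → const (- t)) (λ _ → const (+ 1)) ⟩
    χ M +P sum (λ i → const (- t) *P cofactor i)                ≈⟨ +P-cong (≈ₚ-refl {χ M}) (*-distribˡ-sum (const (- t)) cofactor) ⟨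
    χ M +P (const (- t) *P cofactorSum M)                       ∎
    where
    open ≈ₚ-Reasoning
    cofactor = λ i → det (replaceRow i (λ _ → const (+ 1)) (charMatrix M))
    entrywise : charMatrix (M +J t) ≈ₘ λ i k → charMatrix M i k +P (const (- t) *P const (+ 1))
    entrywise i k = begin
      e +P const (- (M i k + t))
        ≈⟨ +P-cong (≈ₚ-refl {e}) (≈ₚ-reflexive (cong const (ℤ.neg-distrib-+ (M i k) t))) ⟩
      e +P (const (- M i k) +P const (- t))
        ≈⟨ ℤ[X].+-assoc e (const (- M i k)) (const (- t)) ⟨
      (e +P const (- M i k)) +P const (- t)
        ≈⟨ +P-cong (≈ₚ-refl {e +P const (- M i k)}) (ℤ[X].*-identityʳ (const (- t))) ⟨
      (e +P const (- M i k)) +P (const (- t) *P const (+ 1)) ∎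
      where e = if eqB i k then X else []

  coeff-+P-const-*P : ∀ p a q k → coeff (p +P (const a *P q)) k ≡ coeff p k + a * coeff q k
  coeff-+P-const-*P p a q k = ≡.trans (coeff-+P p (const a *P q) k)
    (cong (_+_ (coeff p k)) (≡.trans (coeff-≡ (≈ₚ-sym (scaleP≈const-*P a q)) k) (coeff-scaleP a q k)))

  affine-agreement : ∀ {a b} → a ≢ b → ∀ {p q p′ q′} →
    p +P (const a *P q) ≈ₚ p′ +P (const a *P q′) → p +P (const b *P q) ≈ₚ p′ +P (const b *P q′) →
    p ≈ₚ p′ × q ≈ₚ q′
  affine-agreement {a} {b} a≢b {p} {q} {p′} {q′} at-a at-b = coeffwise p≡p′ , coeffwise q≡q′
    where
    open ≡.≡-Reasoning
    agree : ∀ c → p +P (const c *P q) ≈ₚ p′ +P (const c *P q′) →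
      ∀ k → coeff p k + c * coeff q k ≡ coeff p′ k + c * coeff q′ k
    agree c at-c k = ≡.trans (≡.sym (coeff-+P-const-*P p c q k))
                             (≡.trans (coeff-≡ at-c k) (coeff-+P-const-*P p′ c q′ k))
    difference : ∀ a b x y → (a - b) * y ≡ (x + a * y) - (x + b * y)
    difference = solve-∀
    recover : ∀ a x y → x ≡ (x + a * y) - a * y
    recover = solve-∀
    q≡q′ : ∀ k → coeff q k ≡ coeff q′ k
    q≡q′ k = ℤ.*-cancelˡ-≡ (a - b) (coeff q k) (coeff q′ k) {{≢-nonZero (a≢b ∘ ℤ.i-j≡0⇒i≡j a b)}} (begin
      (a - b) * coeff q k                                            ≡⟨ difference a b (coeff p k) (coeff q k) ⟩
      (coeff p k + a * coeff q k) - (coeff p k + b * coeff q k)      ≡⟨ cong₂ _-_ (agree a at-a k) (agree b at-b k) ⟩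
      (coeff p′ k + a * coeff q′ k) - (coeff p′ k + b * coeff q′ k)  ≡⟨ difference a b (coeff p′ k) (coeff q′ k) ⟨
      (a - b) * coeff q′ k                                           ∎)
    p≡p′ : ∀ k → coeff p k ≡ coeff p′ k
    p≡p′ k = begin
      coeff p k                                       ≡⟨ recover a (coeff p k) (coeff q k) ⟩
      (coeff p k + a * coeff q k) - a * coeff q k     ≡⟨ cong₂ _-_ (agree a at-a k) (cong (a *_) (q≡q′ k)) ⟩
      (coeff p′ k + a * coeff q′ k) - a * coeff q′ k  ≡⟨ recover a (coeff p′ k) (coeff q′ k) ⟨
      coeff p′ k                                      ∎

  χ-shifts⇔ : ∀ {n} {a b} → a ≢ b → (M N : Mat n) →
    (χ (M +J a) ≈ₚ χ (N +J a) × χ (M +J b) ≈ₚ χ (N +J b)) ⇔ (∀ t → χ (M +J t) ≈ₚ χ (N +J t))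
  χ-shifts⇔ {a = a} {b} a≢b M N = mk⇔ every (λ all → all a , all b)
    where
    expanded : ∀ t → χ (M +J t) ≈ₚ χ (N +J t) ⇔
      χ M +P (const (- t) *P cofactorSum M) ≈ₚ χ N +P (const (- t) *P cofactorSum N)
    expanded t = ≈ₚ-cong⇔ (χ-+J M t) (χ-+J N t)
    every : χ (M +J a) ≈ₚ χ (N +J a) × χ (M +J b) ≈ₚ χ (N +J b) → ∀ t → χ (M +J t) ≈ₚ χ (N +J t)
    every (at-a , at-b) t with affine-agreement (a≢b ∘ ℤ.neg-injective) {χ M} {cofactorSum M} {χ N} {cofactorSum N}
                                 (to (expanded a) at-a) (to (expanded b) at-b)
    ... | χM≈χN , σM≈σN = from (expanded t) (+P-cong χM≈χN (ℤ[X].*-congˡ {const (- t)} σM≈σN))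

  entry-∘ₚ : ∀ b m r → ((if b then X else []) +P const m) ∘ₚ r ≈ₚ (if b then r else []) +P const m
  entry-∘ₚ b m r = ≈ₚ-trans (∘ₚ-+P r (if b then X else []) (const m)) (+P-cong (selected b) (const-∘ₚ r m))
    where
    selected : ∀ b → (if b then X else []) ∘ₚ r ≈ₚ (if b then r else [])
    selected true  = X-∘ₚ r
    selected false = ≈ₚ-refl

  linear-∘ₚ : ∀ a b s → (a ∷ b ∷ []) ∘ₚ s ≈ₚ const a +P (s *P const b)
  linear-∘ₚ a b s = +P-cong (≈ₚ-refl {const a}) (ℤ[X].*-congˡ {s} (const-∘ₚ s b))

  χ-scalar⊕ : ∀ {n} c (N : Mat n) → χ (scalar c ⊕ N) ≈ₚ χ N ∘ₚ (- c ∷ + 1 ∷ [])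
  χ-scalar⊕ c N = ≈ₚ-trans (det-cong entrywise) (det-homomorphic (∘ₚ-isRingHomomorphism r) (charMatrix N))
    where
    r = - c ∷ + 1 ∷ []
    shifted : ∀ b m → (if b then X else []) +P const (- (c * (if b then + 1 else + 0) + m)) ≈ₚ
                      (if b then r else []) +P const (- m)
    shifted true  m = coeffwise λ { zero → distribute c m ; (suc zero) → refl ; (suc (suc k)) → refl }
      where
      distribute : ∀ c m → + 0 + - (c * + 1 + m) ≡ - c + - m
      distribute = solve-∀
    shifted false m = ≈ₚ-reflexive (cong const (vanish c m))
      where
      vanish : ∀ c m → - (c * + 0 + m) ≡ - m
      vanish = solve-∀
    entrywise : charMatrix (scalar c ⊕ N) ≈ₘ λ i k → charMatrix N i k ∘ₚ r
    entrywise i k = ≈ₚ-trans (shifted (eqB i k) (N i k)) (≈ₚ-sym (entry-∘ₚ (eqB i k) (- N i k) r))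

  χ-scalar⊖ : ∀ {n} c (N : Mat n) → χ (scalar c ⊖ N) ≈ₚ sign n *P (χ N ∘ₚ (c ∷ - + 1 ∷ []))
  χ-scalar⊖ {n} c N = begin
    χ (scalar c ⊖ N)                                ≈⟨ det-cong entrywise ⟩
    det (λ i k → negP (charMatrix N i k ∘ₚ r))     ≈⟨ det-negate (λ i k → charMatrix N i k ∘ₚ r) ⟩
    sign n *P det (λ i k → charMatrix N i k ∘ₚ r)
      ≈⟨ ℤ[X].*-congˡ {sign n} (det-homomorphic (∘ₚ-isRingHomomorphism r) (charMatrix N)) ⟩
    sign n *P (χ N ∘ₚ r)                            ∎
    where
    open ≈ₚ-Reasoning
    r = c ∷ - + 1 ∷ []
    reflected : ∀ b m → (if b then X else []) +P const (- (c * (if b then + 1 else + 0) - m)) ≈ₚ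
                        negP ((if b then r else []) +P const (- m))
    reflected true  m = coeffwise λ { zero → distribute c m ; (suc zero) → refl ; (suc (suc k)) → refl }
      where
      distribute : ∀ c m → + 0 + - (c * + 1 - m) ≡ - (c + - m)
      distribute = solve-∀
    reflected false m = ≈ₚ-reflexive (cong const (negate c m))
      where
      negate : ∀ c m → - (c * + 0 - m) ≡ - - m
      negate = solve-∀
    entrywise : charMatrix (scalar c ⊖ N) ≈ₘ λ i k → negP (charMatrix N i k ∘ₚ r)
    entrywise i k = ≈ₚ-trans (reflected (eqB i k) (N i k)) (ℤ[X].-‿cong (≈ₚ-sym (entry-∘ₚ (eqB i k) (- N i k) r)))

  χ-scalar⊕⇔ : ∀ {n} c (N N′ : Mat n) → χ (scalar c ⊕ N) ≈ₚ χ (scalar c ⊕ N′) ⇔ χ N ≈ₚ χ N′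
  χ-scalar⊕⇔ c N N′ = mk⇔
    (∘ₚ-cancelʳ r r⁻¹ inverse ∘ to (≈ₚ-cong⇔ (χ-scalar⊕ c N) (χ-scalar⊕ c N′)))
    (from (≈ₚ-cong⇔ (χ-scalar⊕ c N) (χ-scalar⊕ c N′)) ∘ ∘ₚ-congˡ r)
    where
    r r⁻¹ : Poly
    r   = - c ∷ + 1 ∷ []
    r⁻¹ = c ∷ + 1 ∷ []
    inverse : r ∘ₚ r⁻¹ ≈ₚ X
    inverse = ≈ₚ-trans (linear-∘ₚ (- c) (+ 1) r⁻¹) (≈ₚ-trans (+P-cong (≈ₚ-refl {const (- c)}) (ℤ[X].*-identityʳ r⁻¹))
      (coeffwise λ { zero → ℤ.+-inverseˡ c ; (suc zero) → refl ; (suc (suc k)) → refl }))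

  χ-scalar⊖⇔ : ∀ {n} c (N N′ : Mat n) → χ (scalar c ⊖ N) ≈ₚ χ (scalar c ⊖ N′) ⇔ χ N ≈ₚ χ N′
  χ-scalar⊖⇔ {n} c N N′ = mk⇔
    (∘ₚ-cancelʳ r r involution ∘ sign-*-cancelˡ n ∘ to (≈ₚ-cong⇔ (χ-scalar⊖ c N) (χ-scalar⊖ c N′)))
    (from (≈ₚ-cong⇔ (χ-scalar⊖ c N) (χ-scalar⊖ c N′)) ∘ ℤ[X].*-congˡ {sign n} ∘ ∘ₚ-congˡ r)
    where
    r = c ∷ - + 1 ∷ []
    cancel : ∀ c → c + - + 1 * c ≡ + 0
    cancel = solve-∀
    involution : r ∘ₚ r ≈ₚ X
    involution = ≈ₚ-trans (linear-∘ₚ c (- + 1) r) (≈ₚ-trans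
      (+P-cong (≈ₚ-refl {const c}) (≈ₚ-trans (ℤ[X].*-comm r (const (- + 1))) (≈ₚ-sym (scaleP≈const-*P (- + 1) r))))
      (coeffwise λ { zero → cancel c ; (suc zero) → refl ; (suc (suc k)) → refl }))

  data Affine : Set where
    plus minus : (c t : ℤ) → Affine

  apply : ∀ {n} → Affine → Mat n → Mat n
  apply (plus  c t) M = scalar c ⊕ (M +J t)
  apply (minus c t) M = scalar c ⊖ (M +J t)

  offset : Affine → ℤ
  offset (plus  _ t) = t
  offset (minus _ t) = t

  χ-apply⇔ : ∀ {n} f (M N : Mat n) → χ (apply f M) ≈ₚ χ (apply f N) ⇔ χ (M +J offset f) ≈ₚ χ (N +J offset f)
  χ-apply⇔ (plus  c t) M N = χ-scalar⊕⇔ c (M +J t) (N +J t)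
  χ-apply⇔ (minus c t) M N = χ-scalar⊖⇔ c (M +J t) (N +J t)

  record AffineImage {n} (Y : Mat n) (f : Affine) (B : Mat n) : Set where
    constructor affineImage
    field entries : ∀ i j → Y i j ≡ apply f B i j
  open AffineImage public

open AffineTransformations

module DiameterTwo where

  open import Data.Bool using (Bool; true; false; if_then_else_; _∧_; _∨_)
  import Data.Bool.Properties as Bool
  open import Data.Fin using (Fin; zero; suc; _≟_)
  open import Data.Nat using (ℕ; zero; suc; _≤_)
  import Data.Nat as ℕ
  import Data.Nat.Properties as ℕ
  open import Function using (_∘_; case_of_)
  open import Algebra.Properties.CommutativeSemigroup ℕ.+-commutativeSemigroup
    using () renaming (interchange to +-interchange)
  open import Relation.Nullary using (yes; no)
  open import Relation.Binary.PropositionalEquality as ≡ using (_≡_; refl; cong; cong₂)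
  open ≡.≡-Reasoning

  ⟦_⟧ : Bool → ℕ
  ⟦ b ⟧ = if b then 1 else 0

  eqB⇒≡ : ∀ {n} {u v : Fin n} → eqB u v ≡ true → u ≡ v
  eqB⇒≡ {u = u} {v} e with u ≟ v
  eqB⇒≡ e  | yes u≡v = u≡v
  eqB⇒≡ () | no _

  loopless : ∀ {n} (G : Graph n) {u v} → eqB u v ≡ true → adj G u v ≡ false
  loopless G {u} u=v = ≡.trans (cong (adj G u) (≡.sym (eqB⇒≡ u=v))) (irrefl G u)

  sumℕ-cong : ∀ {n} {f g : Fin n → ℕ} → (∀ i → f i ≡ g i) → sumℕ f ≡ sumℕ g
  sumℕ-cong {zero}  f≡g = refl
  sumℕ-cong {suc n} f≡g = cong₂ ℕ._+_ (f≡g zero) (sumℕ-cong (f≡g ∘ suc))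

  sumℕ-+ : ∀ {n} (f g : Fin n → ℕ) → sumℕ (λ i → f i ℕ.+ g i) ≡ sumℕ f ℕ.+ sumℕ g
  sumℕ-+ {zero}  f g = refl
  sumℕ-+ {suc n} f g = ≡.trans (cong (f zero ℕ.+ g zero ℕ.+_) (sumℕ-+ (f ∘ suc) (g ∘ suc)))
                               (+-interchange (f zero) (g zero) (sumℕ (f ∘ suc)) (sumℕ (g ∘ suc)))

  sumℕ-*ˡ : ∀ {n} k (f : Fin n → ℕ) → sumℕ (λ i → k ℕ.* f i) ≡ k ℕ.* sumℕ f
  sumℕ-*ˡ {zero}  k f = ≡.sym (ℕ.*-zeroʳ k)
  sumℕ-*ˡ {suc n} k f = ≡.trans (cong (k ℕ.* f zero ℕ.+_) (sumℕ-*ˡ k (f ∘ suc)))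
                                (≡.sym (ℕ.*-distribˡ-+ k (f zero) (sumℕ (f ∘ suc))))

  sumℕ-ones : ∀ n → sumℕ {n} (λ _ → 1) ≡ n
  sumℕ-ones zero    = refl
  sumℕ-ones (suc n) = cong suc (sumℕ-ones n)

  sumℕ-zeros : ∀ n → sumℕ {n} (λ _ → 0) ≡ 0
  sumℕ-zeros zero    = refl
  sumℕ-zeros (suc n) = sumℕ-zeros n

  sumℕ-eqB : ∀ {n} (v : Fin n) → sumℕ (λ u → ⟦ eqB v u ⟧) ≡ 1
  sumℕ-eqB {suc n} zero    = cong suc (sumℕ-zeros n)
  sumℕ-eqB {suc n} (suc v) = ≡.trans (sumℕ-cong (λ u → cong ⟦_⟧ (eqB-suc v u))) (sumℕ-eqB v)

  deg+deg-compl : ∀ {n} (G : Graph n) v → suc (deg G v ℕ.+ deg (compl G) v) ≡ n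
  deg+deg-compl {n} G v = begin
    suc (deg G v ℕ.+ deg (compl G) v)                          ≡⟨ ℕ.+-comm 1 _ ⟩
    deg G v ℕ.+ deg (compl G) v ℕ.+ 1                          ≡⟨ cong₂ ℕ._+_ (≡.sym (sumℕ-+ a ā)) (≡.sym (sumℕ-eqB v)) ⟩
    sumℕ (λ u → a u ℕ.+ ā u) ℕ.+ sumℕ (λ u → ⟦ eqB v u ⟧)      ≡⟨ sumℕ-+ (λ u → a u ℕ.+ ā u) (λ u → ⟦ eqB v u ⟧) ⟨
    sumℕ (λ u → a u ℕ.+ ā u ℕ.+ ⟦ eqB v u ⟧)                   ≡⟨ sumℕ-cong partition ⟩
    sumℕ {n} (λ _ → 1)                                         ≡⟨ sumℕ-ones n ⟩
    n ∎
    where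
    a ā : Fin _ → ℕ
    a u = ⟦ adj G v u ⟧
    ā u = ⟦ adj (compl G) v u ⟧
    partition : ∀ u → a u ℕ.+ ā u ℕ.+ ⟦ eqB v u ⟧ ≡ 1
    partition u with adj G v u in v~u | eqB v u in v=u
    ... | true  | true  = case (≡.trans (≡.sym v~u) (loopless G v=u)) of λ ()
    ... | true  | false = refl
    ... | false | true  = refl
    ... | false | false = refl

  deg-compl-compl : ∀ {n} (G : Graph n) v → deg (compl (compl G)) v ≡ deg G v
  deg-compl-compl G v = sumℕ-cong λ u → cong ⟦_⟧ (complement-involutive u)
    where
    complement-involutive : ∀ u → adj (compl (compl G)) v u ≡ adj G v u
    complement-involutive u with adj G v u in v~u | eqB v u in v=u
    ... | true  | true  = ≡.trans (≡.sym (loopless G v=u)) v~u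
    ... | true  | false = refl
    ... | false | true  = refl
    ... | false | false = refl

  Dist≤2 : ∀ {n} → Graph n → Set
  Dist≤2 G = ∀ u v → dist G u v ≤ 2

  distance : Bool → Bool → ℕ
  distance same adjacent = if same then 0 else if adjacent then 1 else 2

  anyFin-cong : ∀ {n} {f g : Fin n → Bool} → (∀ i → f i ≡ g i) → anyFin f ≡ anyFin g
  anyFin-cong {zero}  f≡g = refl
  anyFin-cong {suc n} f≡g = cong₂ _∨_ (f≡g zero) (anyFin-cong (f≡g ∘ suc))

  anyFin-false : ∀ n → anyFin {n} (λ _ → false) ≡ false
  anyFin-false zero    = refl
  anyFin-false (suc n) = anyFin-false n

  anyFin-eqB : ∀ {n} (u : Fin n) (g : Fin n → Bool) → anyFin (λ w → eqB u w ∧ g w) ≡ g u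
  anyFin-eqB {suc n} zero    g = ≡.trans (cong (g zero ∨_) (anyFin-false n)) (Bool.∨-identityʳ (g zero))
  anyFin-eqB {suc n} (suc u) g =
    ≡.trans (anyFin-cong λ w → cong (_∧ g (suc w)) (eqB-suc u w)) (anyFin-eqB u (g ∘ suc))

  search-≥ : ∀ {n} (G : Graph n) u v k fuel → k ≤ search G u v k fuel
  search-≥ G u v k zero = ℕ.≤-refl
  search-≥ G u v k (suc fuel) with reach G k u v
  ... | true  = ℕ.≤-refl
  ... | false = ℕ.≤-trans (ℕ.n≤1+n k) (search-≥ G u v (suc k) fuel)

  dist-same : ∀ {n} (G : Graph n) {u v} → eqB u v ≡ true → dist G u v ≡ 0
  dist-same {suc n} G {u} {v} u=v = cong (λ b → if b then 0 else search G u v 1 n) u=v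

  dist-other : ∀ {n} (G : Graph n) {u v} → eqB u v ≡ false → dist G u v ≤ 2 → dist G u v ≡ (if adj G u v then 1 else 2)
  dist-other {suc zero}    G {zero} {zero} () _
  dist-other {suc (suc n)} G {u}    {v}    u≠v d≤2 = ≡.trans unfold (by-adjacency (adj G u v) refl)
    where
    reach₁ : reach G 1 u v ≡ adj G u v
    reach₁ = ≡.trans (cong (_∨ anyFin (λ w → eqB u w ∧ adj G w v)) u≠v) (anyFin-eqB u (λ w → adj G w v))
    later = search G u v 2 n
    unfold : dist G u v ≡ (if reach G 1 u v then 1 else later)
    unfold = cong (λ b → if b then 0 else (if reach G 1 u v then 1 else later)) u≠v
    by-adjacency : ∀ b → adj G u v ≡ b → (if reach G 1 u v then 1 else later) ≡ (if b then 1 else 2)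
    by-adjacency true  u~v = cong (λ b → if b then 1 else later) (≡.trans reach₁ u~v)
    by-adjacency false u≁v = ≡.trans skip
      (ℕ.≤-antisym (ℕ.≤-trans (ℕ.≤-reflexive (≡.sym (≡.trans unfold skip))) d≤2) (search-≥ G u v 2 n))
      where
      skip : (if reach G 1 u v then 1 else later) ≡ later
      skip = cong (λ b → if b then 1 else later) (≡.trans reach₁ u≁v)

  dist-diameter≤2 : ∀ {n} (G : Graph n) → Dist≤2 G → ∀ u v → dist G u v ≡ distance (eqB u v) (adj G u v)
  dist-diameter≤2 G d≤2 u v with eqB u v in u=v
  ... | true  = dist-same G u=v
  ... | false = dist-other G u=v (d≤2 u v)

  trs-diameter≤2 : ∀ {n} (G : Graph n) → Dist≤2 G → ∀ v → trs G v ≡ deg G v ℕ.+ 2 ℕ.* deg (compl G) v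
  trs-diameter≤2 G d≤2 v = begin
    sumℕ (λ u → dist G u v)                         ≡⟨ sumℕ-cong column ⟩
    sumℕ (λ u → a u ℕ.+ 2 ℕ.* ā u)                  ≡⟨ sumℕ-+ a (λ u → 2 ℕ.* ā u) ⟩
    deg G v ℕ.+ sumℕ (λ u → 2 ℕ.* ā u)              ≡⟨ cong (deg G v ℕ.+_) (sumℕ-*ˡ 2 ā) ⟩
    deg G v ℕ.+ 2 ℕ.* deg (compl G) v ∎
    where
    a ā : Fin _ → ℕ
    a u = ⟦ adj G v u ⟧
    ā u = ⟦ adj (compl G) v u ⟧
    column : ∀ u → dist G u v ≡ a u ℕ.+ 2 ℕ.* ā u
    column u rewrite dist-diameter≤2 G d≤2 u v | eqB-sym u v | sym G u v with adj G v u in v~u | eqB v u in v=u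
    ... | true  | true  = case ≡.trans (≡.sym v~u) (loopless G v=u) of λ ()
    ... | true  | false = refl
    ... | false | true  = refl
    ... | false | false = refl

open DiameterTwo

module Shapes where

  open import Data.Bool using (true; false; if_then_else_; _∧_; not)
  open import Data.Integer using (ℤ; +_; -_; _+_; _*_; _-_)
  import Data.Integer.Properties as ℤ
  open import Data.Integer.Tactic.RingSolver using (solve-∀; solve)
  open import Data.List using (_∷_; [])
  import Data.Nat as ℕ
  open import Function using (case_of_)
  open import Relation.Binary.PropositionalEquality as ≡ using (_≡_; refl; cong; cong₂)

  -- ⟨ α , β , γ , δ ⟩ stands for the matrix αI + β·diag(deg G) + γA(G) + δJ.
  record Shape : Set where
    constructor ⟨_,_,_,_⟩
    field diagonal degree adjacency constant : ℤ

  infixl 6 _+ˢ_ _-ˢ_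
  _+ˢ_ _-ˢ_ : Shape → Shape → Shape
  ⟨ α , β , γ , δ ⟩ +ˢ ⟨ α′ , β′ , γ′ , δ′ ⟩ = ⟨ α + α′ , β + β′ , γ + γ′ , δ + δ′ ⟩
  ⟨ α , β , γ , δ ⟩ -ˢ ⟨ α′ , β′ , γ′ , δ′ ⟩ = ⟨ α - α′ , β - β′ , γ - γ′ , δ - δ′ ⟩

  shaped : ∀ {n} → Graph n → Shape → Mat n
  shaped G ⟨ α , β , γ , δ ⟩ i j = (α + β * + deg G i) * Iₘ i j + γ * Aₘ G i j + δ

  infix 4 _≐[_]_
  record _≐[_]_ {n} (M : Mat n) (G : Graph n) (s : Shape) : Set where
    constructor entrywise
    field entry : ∀ i j → M i j ≡ shaped G s i j
  open _≐[_]_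

  module _ {n} {G : Graph n} where

    ⊕-shape : ∀ {M N s s′} → M ≐[ G ] s → N ≐[ G ] s′ → (M ⊕ N) ≐[ G ] (s +ˢ s′)
    ⊕-shape {s = ⟨ α , β , γ , δ ⟩} {⟨ α′ , β′ , γ′ , δ′ ⟩} M≐s N≐s′ = entrywise λ i j →
      ≡.trans (cong₂ _+_ (entry M≐s i j) (entry N≐s′ i j)) (collect (Iₘ i j) (+ deg G i) (Aₘ G i j))
      where
      collect : ∀ e d a → (α + β * d) * e + γ * a + δ + ((α′ + β′ * d) * e + γ′ * a + δ′)
                        ≡ ((α + α′) + (β + β′) * d) * e + (γ + γ′) * a + (δ + δ′)
      collect e d a = solve (α ∷ β ∷ γ ∷ δ ∷ α′ ∷ β′ ∷ γ′ ∷ δ′ ∷ e ∷ d ∷ a ∷ [])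

    ⊖-shape : ∀ {M N s s′} → M ≐[ G ] s → N ≐[ G ] s′ → (M ⊖ N) ≐[ G ] (s -ˢ s′)
    ⊖-shape {s = ⟨ α , β , γ , δ ⟩} {⟨ α′ , β′ , γ′ , δ′ ⟩} M≐s N≐s′ = entrywise λ i j →
      ≡.trans (cong₂ _-_ (entry M≐s i j) (entry N≐s′ i j)) (collect (Iₘ i j) (+ deg G i) (Aₘ G i j))
      where
      collect : ∀ e d a → (α + β * d) * e + γ * a + δ - ((α′ + β′ * d) * e + γ′ * a + δ′)
                        ≡ ((α - α′) + (β - β′) * d) * e + (γ - γ′) * a + (δ - δ′)
      collect e d a = solve (α ∷ β ∷ γ ∷ δ ∷ α′ ∷ β′ ∷ γ′ ∷ δ′ ∷ e ∷ d ∷ a ∷ [])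

    IAJ-shape : ∀ {M α γ δ} → (∀ i j → M i j ≡ α * Iₘ i j + γ * Aₘ G i j + δ) → M ≐[ G ] ⟨ α , + 0 , γ , δ ⟩
    IAJ-shape {α = α} {γ} {δ} M≡ = entrywise λ i j → ≡.trans (M≡ i j) (pad (Iₘ i j) (+ deg G i) (Aₘ G i j))
      where
      pad : ∀ e d a → α * e + γ * a + δ ≡ (α + + 0 * d) * e + γ * a + δ
      pad e d a = solve (α ∷ γ ∷ δ ∷ e ∷ d ∷ a ∷ [])

    diag-shape : ∀ {f α β} → (∀ i → + f i ≡ α + β * + deg G i) → diag f ≐[ G ] ⟨ α , β , + 0 , + 0 ⟩
    diag-shape {f} {α} {β} f≡ = entrywise λ i j →
      ≡.trans (select (eqB i j) (+ f i))
              (≡.trans (cong (_* Iₘ i j) (f≡ i)) (pad (α + β * + deg G i) (Iₘ i j) (Aₘ G i j)))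
      where
      select : ∀ e x → (if e then x else + 0) ≡ x * (if e then + 1 else + 0)
      select true  x = ≡.sym (ℤ.*-identityʳ x)
      select false x = ≡.sym (ℤ.*-zeroʳ x)
      pad : ∀ x e a → x * e ≡ x * e + + 0 * a + + 0
      pad x e a = solve (x ∷ e ∷ a ∷ [])

    plus-form : ∀ {M B α β γ δ} → M ≐[ G ] ⟨ α , β , γ , δ ⟩ → B ≐[ G ] ⟨ + 0 , β , γ , + 0 ⟩ →
      AffineImage M (plus α δ) B
    plus-form {B = B} {α} {β} {γ} {δ} M≐ B≐ = affineImage λ i j → ≡.trans (entry M≐ i j)
      (≡.trans (regroup (Iₘ i j) (+ deg G i) (Aₘ G i j)) (cong (λ b → α * Iₘ i j + (b + δ)) (≡.sym (entry B≐ i j))))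
      where
      regroup : ∀ e d a → (α + β * d) * e + γ * a + δ ≡ α * e + ((+ 0 + β * d) * e + γ * a + + 0 + δ)
      regroup e d a = solve (α ∷ β ∷ γ ∷ δ ∷ e ∷ d ∷ a ∷ [])

    minus-form : ∀ {M B α β γ δ} → M ≐[ G ] ⟨ α , - β , - γ , δ ⟩ → B ≐[ G ] ⟨ + 0 , β , γ , + 0 ⟩ →
      AffineImage M (minus α (- δ)) B
    minus-form {B = B} {α} {β} {γ} {δ} M≐ B≐ = affineImage λ i j → ≡.trans (entry M≐ i j)
      (≡.trans (regroup (Iₘ i j) (+ deg G i) (Aₘ G i j)) (cong (λ b → α * Iₘ i j - (b + - δ)) (≡.sym (entry B≐ i j))))
      where
      regroup : ∀ e d a → (α + - β * d) * e + - γ * a + δ ≡ α * e - ((+ 0 + β * d) * e + γ * a + + 0 + - δ)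
      regroup e d a = solve (α ∷ β ∷ γ ∷ δ ∷ e ∷ d ∷ a ∷ [])

  module _ {n} (G : Graph n) where

    A-shape : Aₘ G ≐[ G ] ⟨ + 0 , + 0 , + 1 , + 0 ⟩
    A-shape = IAJ-shape λ i j → table (eqB i j) (adj G i j)
      where
      table : ∀ e x → (if x then + 1 else + 0) ≡ + 0 * (if e then + 1 else + 0) + + 1 * (if x then + 1 else + 0) + + 0
      table true  true  = refl
      table true  false = refl
      table false true  = refl
      table false false = refl

    A-compl-shape : Aₘ (compl G) ≐[ G ] ⟨ - + 1 , + 0 , - + 1 , + 1 ⟩
    A-compl-shape = IAJ-shape λ i j → table (eqB i j) (adj G i j) (loopless G)
      where
      table : ∀ e x → (e ≡ true → x ≡ false) →
        (if not x ∧ not e then + 1 else + 0) ≡ - + 1 * (if e then + 1 else + 0) + - + 1 * (if x then + 1 else + 0) + + 1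
      table true  true  e⇒¬x = case e⇒¬x refl of λ ()
      table true  false _    = refl
      table false true  _    = refl
      table false false _    = refl

    D-shape : Dist≤2 G → Dₘ G ≐[ G ] ⟨ - + 2 , + 0 , - + 1 , + 2 ⟩
    D-shape d≤2 = IAJ-shape λ i j →
      ≡.trans (cong +_ (dist-diameter≤2 G d≤2 i j)) (table (eqB i j) (adj G i j) (loopless G))
      where
      table : ∀ e x → (e ≡ true → x ≡ false) →
        + distance e x ≡ - + 2 * (if e then + 1 else + 0) + - + 1 * (if x then + 1 else + 0) + + 2
      table true  true  e⇒¬x = case e⇒¬x refl of λ ()
      table true  false _    = refl
      table false true  _    = refl
      table false false _    = refl

    D-compl-shape : Dist≤2 (compl G) → Dₘ (compl G) ≐[ G ] ⟨ - + 1 , + 0 , + 1 , + 1 ⟩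
    D-compl-shape d≤2 = IAJ-shape λ i j →
      ≡.trans (cong +_ (dist-diameter≤2 (compl G) d≤2 i j)) (table (eqB i j) (adj G i j) (loopless G))
      where
      table : ∀ e x → (e ≡ true → x ≡ false) →
        + distance e (not x ∧ not e) ≡ - + 1 * (if e then + 1 else + 0) + + 1 * (if x then + 1 else + 0) + + 1
      table true  true  e⇒¬x = case e⇒¬x refl of λ ()
      table true  false _    = refl
      table false true  _    = refl
      table false false _    = refl

    order-via-degrees : ∀ v → + n ≡ + 1 + (+ deg G v + + deg (compl G) v)
    order-via-degrees v = ≡.trans (cong +_ (≡.sym (deg+deg-compl G v)))
      (≡.trans (ℤ.pos-+ 1 (deg G v ℕ.+ deg (compl G) v)) (cong (_+_ (+ 1)) (ℤ.pos-+ (deg G v) (deg (compl G) v))))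

    pos-+2* : ∀ a b → + (a ℕ.+ 2 ℕ.* b) ≡ + a + + 2 * + b
    pos-+2* a b = ≡.trans (ℤ.pos-+ a (2 ℕ.* b)) (cong (_+_ (+ a)) (ℤ.pos-* 2 b))

    deg-shape : diag (deg G) ≐[ G ] ⟨ + 0 , + 1 , + 0 , + 0 ⟩
    deg-shape = diag-shape λ i → ≡.sym (≡.trans (ℤ.+-identityˡ _) (ℤ.*-identityˡ _))

    deg-compl-shape : diag (deg (compl G)) ≐[ G ] ⟨ + n - + 1 , - + 1 , + 0 , + 0 ⟩
    deg-compl-shape = diag-shape λ i → ≡.trans (identity (+ deg G i) (+ deg (compl G) i))
      (cong (λ N → N - + 1 + - + 1 * + deg G i) (≡.sym (order-via-degrees i)))
      where
      identity : ∀ d d̄ → d̄ ≡ (+ 1 + (d + d̄)) - + 1 + - + 1 * d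
      identity = solve-∀

    trs-shape : Dist≤2 G → diag (trs G) ≐[ G ] ⟨ + 2 * (+ n - + 1) , - + 1 , + 0 , + 0 ⟩
    trs-shape d≤2 = diag-shape λ i → ≡.trans (cong +_ (trs-diameter≤2 G d≤2 i))
      (≡.trans (pos-+2* (deg G i) (deg (compl G) i)) (≡.trans (identity (+ deg G i) (+ deg (compl G) i))
        (cong (λ N → + 2 * (N - + 1) + - + 1 * + deg G i) (≡.sym (order-via-degrees i)))))
      where
      identity : ∀ d d̄ → d + + 2 * d̄ ≡ + 2 * ((+ 1 + (d + d̄)) - + 1) + - + 1 * d
      identity = solve-∀

    trs-compl-shape : Dist≤2 (compl G) → diag (trs (compl G)) ≐[ G ] ⟨ + n - + 1 , + 1 , + 0 , + 0 ⟩
    trs-compl-shape d≤2 = diag-shape λ i → ≡.trans (cong +_ (trs-diameter≤2 (compl G) d≤2 i))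
      (≡.trans (cong (λ d → + (deg (compl G) i ℕ.+ 2 ℕ.* d)) (deg-compl-compl G i))
      (≡.trans (pos-+2* (deg (compl G) i) (deg G i)) (≡.trans (identity (+ deg G i) (+ deg (compl G) i))
        (cong (λ N → N - + 1 + + 1 * + deg G i) (≡.sym (order-via-degrees i))))))
      where
      identity : ∀ d d̄ → d̄ + + 2 * d ≡ (+ 1 + (d + d̄)) - + 1 + + 1 * d
      identity = solve-∀

    L-shape : Lₘ G ≐[ G ] ⟨ + 0 , + 1 , - + 1 , + 0 ⟩
    L-shape = ⊖-shape deg-shape A-shape

    Q-shape : Qₘ G ≐[ G ] ⟨ + 0 , + 1 , + 1 , + 0 ⟩
    Q-shape = ⊕-shape deg-shape A-shape

open Shapes

open import Data.Nat using (ℕ)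
open import Data.Product using (_×_; _,_; proj₁; proj₂)
open import Data.Product.Function.NonDependent.Propositional using (_×-⇔_)
open import Function using (_∘_)
open import Function.Bundles using (_⇔_; mk⇔; Equivalence)
open import Function.Construct.Composition using (_⇔-∘_)
open import Relation.Binary.PropositionalEquality using (_≢_; refl)
open Equivalence using (to; from)

-- Whenever G and Ḡ have diameter at most 2, Y(G) and Y(Ḡ) arise from B(G) by affine maps that
-- depend only on the order and have different offsets. In the instances below the parameters of
-- these maps are inferred from the shape computations.
record AffineOver (B Y : MatFam) : Set where
  field
    onGraph onComplement : ℕ → Affine
    offsets-differ : ∀ n → offset (onGraph n) ≢ offset (onComplement n)
    graph-form : ∀ {n} (G : Graph n) → Dist≤2 G → Dist≤2 (compl G) → AffineImage (Y G) (onGraph n) (B G)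
    complement-form : ∀ {n} (G : Graph n) → Dist≤2 G → Dist≤2 (compl G) →
      AffineImage (Y (compl G)) (onComplement n) (B G)

genCospectral⇔shifts : ∀ {B Y : MatFam} → AffineOver B Y → ∀ {n} (G H : Graph n) →
  Dist≤2 G → Dist≤2 (compl G) → Dist≤2 H → Dist≤2 (compl H) →
  GenCospectral Y G H ⇔ (∀ t → χ (B G +J t) ≈ₚ χ (B H +J t))
genCospectral⇔shifts {B} {Y} Y/B {n} G H dG dḠ dH dH̄ =
  χ-shifts⇔ (offsets-differ n) (B G) (B H) ⇔-∘
  ((χ-apply⇔ (onGraph n) (B G) (B H) ×-⇔ χ-apply⇔ (onComplement n) (B G) (B H)) ⇔-∘
   (transport (graph-form G dG dḠ) (graph-form H dH dH̄) ×-⇔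
    transport (complement-form G dG dḠ) (complement-form H dH dH̄)))
  where
  open AffineOver Y/B
  transport : ∀ {M N f} → AffineImage M f (B G) → AffineImage N f (B H) →
    Cospectral M N ⇔ χ (apply f (B G)) ≈ₚ χ (apply f (B H))
  transport {M} {N} M≡ N≡ = ≈ₚ-cong⇔ (χ-cong (entries M≡)) (χ-cong (entries N≡)) ⇔-∘ cospectral⇔χ≈ M N

genCospectral-transfer : ∀ {B Y Y′ : MatFam} → AffineOver B Y → AffineOver B Y′ →
  ∀ {n m} (G : Graph n) (H : Graph m) → Dist≤2 G → Dist≤2 (compl G) → Dist≤2 H → Dist≤2 (compl H) →
  GenCospectral Y G H → GenCospectral Y′ G H
genCospectral-transfer {Y = Y} Y/B Y′/B G H dG dḠ dH dH̄ cosp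
  with cospectral⇒sameOrder (Y G) (Y H) (proj₁ cosp)
... | refl = from (genCospectral⇔shifts Y′/B G H dG dḠ dH dH̄)
                  (to (genCospectral⇔shifts Y/B G H dG dḠ dH dH̄) cosp)

A-over-A : AffineOver Aₘ Aₘ
A-over-A = record
  { onGraph = λ _ → plus _ _ ; onComplement = λ _ → minus _ _ ; offsets-differ = λ _ ()
  ; graph-form = λ G _ _ → plus-form (A-shape G) (A-shape G)
  ; complement-form = λ G _ _ → minus-form (A-compl-shape G) (A-shape G) }

D-over-A : AffineOver Aₘ Dₘ
D-over-A = record
  { onGraph = λ _ → minus _ _ ; onComplement = λ _ → plus _ _ ; offsets-differ = λ _ ()
  ; graph-form = λ G dG _ → minus-form (D-shape G dG) (A-shape G)
  ; complement-form = λ G _ dḠ → plus-form (D-compl-shape G dḠ) (A-shape G) }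

L-over-L : AffineOver Lₘ Lₘ
L-over-L = record
  { onGraph = λ _ → plus _ _ ; onComplement = λ _ → minus _ _ ; offsets-differ = λ _ ()
  ; graph-form = λ G _ _ → plus-form (L-shape G) (L-shape G)
  ; complement-form = λ G _ _ → minus-form (⊖-shape (deg-compl-shape G) (A-compl-shape G)) (L-shape G) }

DL-over-L : AffineOver Lₘ DLₘ
DL-over-L = record
  { onGraph = λ _ → minus _ _ ; onComplement = λ _ → plus _ _ ; offsets-differ = λ _ ()
  ; graph-form = λ G dG _ → minus-form (⊖-shape (trs-shape G dG) (D-shape G dG)) (L-shape G)
  ; complement-form = λ G _ dḠ → plus-form (⊖-shape (trs-compl-shape G dḠ) (D-compl-shape G dḠ)) (L-shape G) }

Ddeg+-over-L : AffineOver Lₘ Ddeg+ₘ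
Ddeg+-over-L = record
  { onGraph = λ _ → plus _ _ ; onComplement = λ _ → minus _ _ ; offsets-differ = λ _ ()
  ; graph-form = λ G dG _ → plus-form (⊕-shape (deg-shape G) (D-shape G dG)) (L-shape G)
  ; complement-form = λ G _ dḠ → minus-form (⊕-shape (deg-compl-shape G) (D-compl-shape G dḠ)) (L-shape G) }

Atrs+-over-L : AffineOver Lₘ Atrs+ₘ
Atrs+-over-L = record
  { onGraph = λ _ → minus _ _ ; onComplement = λ _ → plus _ _ ; offsets-differ = λ _ ()
  ; graph-form = λ G dG _ → minus-form (⊕-shape (trs-shape G dG) (A-shape G)) (L-shape G)
  ; complement-form = λ G _ dḠ → plus-form (⊕-shape (trs-compl-shape G dḠ) (A-compl-shape G)) (L-shape G) }

Q-over-Q : AffineOver Qₘ Qₘ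
Q-over-Q = record
  { onGraph = λ _ → plus _ _ ; onComplement = λ _ → minus _ _ ; offsets-differ = λ _ ()
  ; graph-form = λ G _ _ → plus-form (Q-shape G) (Q-shape G)
  ; complement-form = λ G _ _ → minus-form (⊕-shape (deg-compl-shape G) (A-compl-shape G)) (Q-shape G) }

DQ-over-Q : AffineOver Qₘ DQₘ
DQ-over-Q = record
  { onGraph = λ _ → minus _ _ ; onComplement = λ _ → plus _ _ ; offsets-differ = λ _ ()
  ; graph-form = λ G dG _ → minus-form (⊕-shape (trs-shape G dG) (D-shape G dG)) (Q-shape G)
  ; complement-form = λ G _ dḠ → plus-form (⊕-shape (trs-compl-shape G dḠ) (D-compl-shape G dḠ)) (Q-shape G) }

Ddeg-over-Q : AffineOver Qₘ Ddegₘ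
Ddeg-over-Q = record
  { onGraph = λ _ → plus _ _ ; onComplement = λ _ → minus _ _ ; offsets-differ = λ _ ()
  ; graph-form = λ G dG _ → plus-form (⊖-shape (deg-shape G) (D-shape G dG)) (Q-shape G)
  ; complement-form = λ G _ dḠ → minus-form (⊖-shape (deg-compl-shape G) (D-compl-shape G dḠ)) (Q-shape G) }

Atrs-over-Q : AffineOver Qₘ Atrsₘ
Atrs-over-Q = record
  { onGraph = λ _ → minus _ _ ; onComplement = λ _ → plus _ _ ; offsets-differ = λ _ ()
  ; graph-form = λ G dG _ → minus-form (⊖-shape (trs-shape G dG) (A-shape G)) (Q-shape G)
  ; complement-form = λ G _ dḠ → plus-form (⊖-shape (trs-compl-shape G dḠ) (A-compl-shape G)) (Q-shape G) }

mainTheorem8 : ∀ {n m} (G : Graph n) (H : Graph m) →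
    HasDiameter G 2 → HasDiameter H 2 →
    HasDiameter (compl G) 2 → HasDiameter (compl H) 2 →
    (GenCospectral Aₘ G H ⇔ GenCospectral Dₘ G H)
    × ((GenCospectral Lₘ G H ⇔ GenCospectral DLₘ G H)
       × (GenCospectral Lₘ G H ⇔ GenCospectral Ddeg+ₘ G H)
       × (GenCospectral Lₘ G H ⇔ GenCospectral Atrs+ₘ G H))
    × ((GenCospectral Qₘ G H ⇔ GenCospectral DQₘ G H)
       × (GenCospectral Qₘ G H ⇔ GenCospectral Ddegₘ G H)
       × (GenCospectral Qₘ G H ⇔ GenCospectral Atrsₘ G H))
mainTheorem8 G H G-diam H-diam Ḡ-diam H̄-diam =
    equivalent A-over-A D-over-A
  , (equivalent L-over-L DL-over-L , equivalent L-over-L Ddeg+-over-L , equivalent L-over-L Atrs+-over-L)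
  , (equivalent Q-over-Q DQ-over-Q , equivalent Q-over-Q Ddeg-over-Q , equivalent Q-over-Q Atrs-over-Q)
  where
  -- of the diameter hypotheses only the bound dist ≤ 2 is used
  bound : ∀ {k} {F : Graph k} → HasDiameter F 2 → Dist≤2 F
  bound = proj₁ ∘ proj₂
  transfer : ∀ {B Y Y′ : MatFam} → AffineOver B Y → AffineOver B Y′ → GenCospectral Y G H → GenCospectral Y′ G H
  transfer Y/B Y′/B = genCospectral-transfer Y/B Y′/B G H (bound G-diam) (bound Ḡ-diam) (bound H-diam) (bound H̄-diam)
  equivalent : ∀ {B Y Y′ : MatFam} → AffineOver B Y → AffineOver B Y′ → GenCospectral Y G H ⇔ GenCospectral Y′ G H
  equivalent Y/B Y′/B = mk⇔ (transfer Y/B Y′/B) (transfer Y′/B Y/B)
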